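{- For every integer $k>1$, \[ \left|\mathrm{Inc}_{\mathrm{Packed}}^{3+k}(3 \times k)\right| = \left|\mathrm{SYT}(2^3, 1^{k-2})\right|. \]
   Context: An increasing tableau of shape $\lambda$ (an integer partition) is a filling of the Young diagram of $\lambda$ with positive integers strictly increasing along rows and down columns. A tableau $T$ is packed if every value $1,\ldots,\max(T)$ appears. $\mathrm{Inc}_{\mathrm{Packed}}^m(\lambda)$ is the set of packed increasing tableaux of shape $\lambda$ with maximum entry exactly $m$. $3\times k$ denotes the rectangular partition $(k,k,k)$. $\mathrm{SYT}(\lambda)$ is the set of standard Young tableaux of shape $\lambda$ (fillings of $\lambda$ with $1,\ldots,|\lambda|$, each once, increasing along rows and columns); $(2^3,1^{k-2})$ is the partition with three parts $2$ followed by $k-2$ parts $1$. -}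

module Defs where

open import Data.Bool using (Bool; true; false; _∧_; T)
open import Data.Nat using (ℕ; zero; suc; _+_; _∸_; _⊔_; _<ᵇ_; _≡ᵇ_; _≤ᵇ_)
open import Data.List using (List; []; _∷_; map; length; concat; replicate; _++_; upTo; zipWith; filter; foldr)
open import Data.Bool.ListAction using (all; any)
open import Data.Nat.ListAction using (sum)
open import Data.Product using (Σ)

-- A partition (shape) is a weakly decreasing list of positive row lengths.
Partition : Set
Partition = List ℕ

-- A filling of a Young diagram, given row by row (row i = list of its entries, left to right).
Filling : Set
Filling = List (List ℕ)

shape : Filling → Partition
shape F = map length F

entries : Filling → List ℕ
entries F = concat F

eqListᵇ : List ℕ → List ℕ → Bool
eqListᵇ [] [] = true
eqListᵇ (x ∷ xs) (y ∷ ys) = (x ≡ᵇ y) ∧ eqListᵇ xs ys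
eqListᵇ _ _ = false

rowIncᵇ : List ℕ → Bool
rowIncᵇ [] = true
rowIncᵇ (x ∷ []) = true
rowIncᵇ (x ∷ y ∷ r) = (x <ᵇ y) ∧ rowIncᵇ (y ∷ r)

colIncᵇ : List ℕ → List ℕ → Bool
colIncᵇ upper lower = all (λ b → b) (zipWith _<ᵇ_ upper lower)

colsIncᵇ : Filling → Bool
colsIncᵇ [] = true
colsIncᵇ (r ∷ []) = true
colsIncᵇ (r ∷ s ∷ F) = colIncᵇ r s ∧ colsIncᵇ (s ∷ F)

isIncreasingᵇ : Partition → Filling → Bool
isIncreasingᵇ λ′ F =
  eqListᵇ (shape F) λ′ ∧ all (1 ≤ᵇ_) (entries F) ∧ all rowIncᵇ F ∧ colsIncᵇ F

maxEntry : Filling → ℕ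
maxEntry F = foldr _⊔_ 0 (entries F)

oneTo : ℕ → List ℕ
oneTo m = map suc (upTo m)

occursᵇ : ℕ → List ℕ → Bool
occursᵇ v xs = any (v ≡ᵇ_) xs

countᵇ : ℕ → List ℕ → ℕ
countᵇ v xs = length (filter (λ x → v Data.Nat.≟ x) xs)

isPackedᵇ : Filling → Bool
isPackedᵇ F = all (λ v → occursᵇ v (entries F)) (oneTo (maxEntry F))

-- Inc_Packed^m(λ) as a type (boolean predicate, so membership proofs are unique)
IncPacked : ℕ → Partition → Set
IncPacked m λ′ =
  Σ Filling (λ F → T (isIncreasingᵇ λ′ F ∧ isPackedᵇ F ∧ (maxEntry F ≡ᵇ m)))

isSYTᵇ : Partition → Filling → Bool
isSYTᵇ λ′ F =
  eqListᵇ (shape F) λ′ ∧ all rowIncᵇ F ∧ colsIncᵇ F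
  ∧ all (λ x → (1 ≤ᵇ x) ∧ (x ≤ᵇ sum λ′)) (entries F)
  ∧ all (λ v → countᵇ v (entries F) ≡ᵇ 1) (oneTo (sum λ′))

SYT : Partition → Set
SYT λ′ = Σ Filling (λ F → T (isSYTᵇ λ′ F))

rect3 : ℕ → Partition
rect3 k = replicate 3 k

hook2³1 : ℕ → Partition
hook2³1 k = replicate 3 2 ++ replicate (k ∸ 2) 1

-- In a packed increasing 3 × k tableau with maximum k + 3, positivity, the bound k + 3 and strict
-- increase down the columns squeeze row i between {i, …, i + k - 1} and {i + 1, …, i + k}, so the
-- row is {i, …, i + k} with a single value i + tᵢ left out. The tableau is thus encoded by a
-- triple t₃ ≤ t₂ ≤ t₁ ≤ k with t₃ < k such that the values 1, 2, 3 + t₃ and 2 + k still occur.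
-- A standard tableau of shape (2³, 1^(k-2)) is encoded by its second column a < b < c, the first
-- column being the complement in {1, …, k + 4}; the only constraints are 2 ≤ a, 4 ≤ b, 6 ≤ c ≤ k + 4.
-- The map (t₁, t₂, t₃) ↦ (2 + t₃, 3 + t₂, 4 + t₁), redefined on the triples with t₂ = 0 and on
-- (1, 1, 0) and (1, 1, 1), is a bijection between the two sets of triples.

{-# OPTIONS --safe #-}
module Submission where

open import Defs
open import Data.Nat using (ℕ; _<_; _+_)
open import Function.Bundles using (_↔_)

open import Data.Bool using (Bool; _∧_; T)
open import Data.Bool.ListAction using (all)
open import Data.Bool.Properties using (T-∧; T-irrelevant)
open import Data.Empty using (⊥-elim)
open import Data.List using (List; []; _∷_; _++_; [_]; length; map; replicate; foldr; filter)
open import Data.List.Membership.DecPropositional Data.Nat._≟_ using (_∈?_)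
open import Data.List.Membership.Propositional using (_∈_; _∉_)
open import Data.List.Membership.Propositional.Properties
  using (∈-map⁺; ∈-map⁻; ∈-upTo⁺; ∈-upTo⁻; ∈-++⁺ˡ; ∈-++⁺ʳ; ∈-++⁻; ∈-filter⁺; ∈-filter⁻; foldr-selective)
open import Data.List.Properties
  using (concat-map-[_]; ∷-injective; length-++; filter-++; filter-some; filter-none; filter-accept; filter-reject)
open import Data.List.Relation.Binary.Permutation.Propositional
  using (_↭_; prep; swap; ↭-trans; ↭-sym; ↭-reflexive)
open import Data.List.Relation.Binary.Permutation.Propositional.Properties
  using (++-comm; shifts; ↭-length; filter-↭; ∈-resp-↭)
open import Data.List.Relation.Binary.Pointwise using (Pointwise; []; _∷_; Pointwise-≡⇒≡)
open import Data.List.Relation.Binary.Pointwise.Properties using (Pointwise-length; antisymmetric; transitive)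
open import Data.List.Relation.Unary.All as All using (All; []; _∷_)
open import Data.List.Relation.Unary.All.Properties using (all⁺; all⁻; ¬Any⇒All¬)
open import Data.List.Relation.Unary.AllPairs using (AllPairs; []; _∷_)
import Data.List.Relation.Unary.AllPairs.Properties as AllPairs
open import Data.List.Relation.Unary.Any as Any using (here; there)
open import Data.List.Relation.Unary.Any.Properties using (any⁺; any⁻)
open import Data.List.Relation.Unary.Linked using (Linked; []; [-]; _∷_)
open import Data.List.Relation.Unary.Linked.Properties using (Linked⇒AllPairs; AllPairs⇒Linked)
open import Data.Nat using (zero; suc; _∸_; _⊔_; _≤_; z≤n; s≤s; _≤ᵇ_; _<ᵇ_; _≡ᵇ_)
open import Data.Nat.ListAction using (sum)
open import Data.Nat.Properties
open import Data.Product using (Σ; ∃; _×_; _,_; proj₁; proj₂; uncurry)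
open import Data.Sum using (_⊎_; inj₁; inj₂)
open import Function using (_∘_; Equivalence)
open import Function.Bundles using (mk↔ₛ′)
open import Relation.Binary.Definitions using (tri<; tri≈; tri>)
open import Relation.Binary.PropositionalEquality using (_≡_; _≢_; refl; sym; trans; cong; cong₂; subst)
open import Relation.Nullary using (¬_; yes; no; ¬?)
open import Relation.Nullary.Decidable using (_×-dec_)
open import Relation.Unary using (Decidable)

-- The first conjunct is explicit: it cannot be recovered from a reduced T (a ∧ b).
T-∧⁻ : ∀ a {b} → T (a ∧ b) → T a × T b
T-∧⁻ _ = Equivalence.to T-∧

T-∧⁺ : ∀ {a b} → T a → T b → T (a ∧ b)
T-∧⁺ p q = Equivalence.from T-∧ (p , q)

eqListᵇ⇒≡ : ∀ xs ys → T (eqListᵇ xs ys) → xs ≡ ys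
eqListᵇ⇒≡ [] [] _ = refl
eqListᵇ⇒≡ (x ∷ xs) (y ∷ ys) h =
  let x≡y , xs≡ys = T-∧⁻ (x ≡ᵇ y) h in cong₂ _∷_ (≡ᵇ⇒≡ x y x≡y) (eqListᵇ⇒≡ xs ys xs≡ys)

eqListᵇ-refl : ∀ xs → T (eqListᵇ xs xs)
eqListᵇ-refl [] = _
eqListᵇ-refl (x ∷ xs) = T-∧⁺ (≡⇒≡ᵇ x x refl) (eqListᵇ-refl xs)

Increasing : List ℕ → Set
Increasing = AllPairs _<_

rowIncᵇ⇒Linked : ∀ xs → T (rowIncᵇ xs) → Linked _<_ xs
rowIncᵇ⇒Linked [] _ = []
rowIncᵇ⇒Linked (x ∷ []) _ = [-]
rowIncᵇ⇒Linked (x ∷ y ∷ xs) h =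
  let x<y , rest = T-∧⁻ (x <ᵇ y) h in <ᵇ⇒< x y x<y ∷ rowIncᵇ⇒Linked (y ∷ xs) rest

rowIncᵇ⇒increasing : ∀ xs → T (rowIncᵇ xs) → Increasing xs
rowIncᵇ⇒increasing xs = Linked⇒AllPairs <-trans ∘ rowIncᵇ⇒Linked xs

increasing⇒rowIncᵇ : ∀ {xs} → Increasing xs → T (rowIncᵇ xs)
increasing⇒rowIncᵇ [] = _
increasing⇒rowIncᵇ ([] ∷ _) = _
increasing⇒rowIncᵇ ((x<y ∷ _) ∷ inc@(_ ∷ _)) = T-∧⁺ (<⇒<ᵇ x<y) (increasing⇒rowIncᵇ inc)

colIncᵇ⇒Pointwise : ∀ xs ys → length xs ≡ length ys → T (colIncᵇ xs ys) → Pointwise _<_ xs ys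
colIncᵇ⇒Pointwise [] [] _ _ = []
colIncᵇ⇒Pointwise (x ∷ xs) (y ∷ ys) eq h =
  let x<y , rest = T-∧⁻ (x <ᵇ y) h in <ᵇ⇒< x y x<y ∷ colIncᵇ⇒Pointwise xs ys (suc-injective eq) rest

Pointwise⇒colIncᵇ : ∀ {xs ys} → Pointwise _<_ xs ys → T (colIncᵇ xs ys)
Pointwise⇒colIncᵇ [] = _
Pointwise⇒colIncᵇ (x<y ∷ xs<ys) = T-∧⁺ (<⇒<ᵇ x<y) (Pointwise⇒colIncᵇ xs<ys)

occursᵇ⇒∈ : ∀ {v} xs → T (occursᵇ v xs) → v ∈ xs
occursᵇ⇒∈ xs h = Any.map (≡ᵇ⇒≡ _ _) (any⁻ _ xs h)

∈⇒occursᵇ : ∀ {v xs} → v ∈ xs → T (occursᵇ v xs)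
∈⇒occursᵇ {v} v∈xs = any⁺ _ (Any.map (λ { refl → ≡⇒≡ᵇ v v refl }) v∈xs)

all⇒∈ : ∀ (p : ℕ → Bool) {xs v} → T (all p xs) → v ∈ xs → T (p v)
all⇒∈ p {xs} h = All.lookup (all⁺ p xs h)

∈⇒all : ∀ (p : ℕ → Bool) {xs} → (∀ {v} → v ∈ xs → T (p v)) → T (all p xs)
∈⇒all p f = all⁻ p (All.tabulate f)

∈-oneTo⁺ : ∀ {m v} → 1 ≤ v → v ≤ m → v ∈ oneTo m
∈-oneTo⁺ {v = suc i} _ i<m = ∈-map⁺ suc (∈-upTo⁺ i<m)

∈-oneTo⁻ : ∀ {m v} → v ∈ oneTo m → 1 ≤ v × v ≤ m
∈-oneTo⁻ v∈ with ∈-map⁻ suc v∈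
... | i , i∈ , refl = s≤s z≤n , ∈-upTo⁻ i∈

all-oneTo⁻ : ∀ (p : ℕ → Bool) {m v} → T (all p (oneTo m)) → 1 ≤ v → v ≤ m → T (p v)
all-oneTo⁻ p h 1≤v v≤m = all⇒∈ p h (∈-oneTo⁺ 1≤v v≤m)

all-oneTo⁺ : ∀ (p : ℕ → Bool) {m} → (∀ {v} → 1 ≤ v → v ≤ m → T (p v)) → T (all p (oneTo m))
all-oneTo⁺ p f = ∈⇒all p (uncurry f ∘ ∈-oneTo⁻)

∈-head-≤ : ∀ {x xs v} → All (x <_) xs → v ∈ x ∷ xs → x ≤ v
∈-head-≤ _ (here refl) = ≤-refl
∈-head-≤ x<xs (there v∈xs) = <⇒≤ (All.lookup x<xs v∈xs)

∈-∷-above : ∀ {x xs v} → x < v → v ∈ x ∷ xs → v ∈ xs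
∈-∷-above x<v (here refl) = ⊥-elim (<-irrefl refl x<v)
∈-∷-above _ (there v∈xs) = v∈xs

increasing-⊆-antisym : ∀ {xs ys} → Increasing xs → Increasing ys →
                       (∀ {v} → v ∈ xs → v ∈ ys) → (∀ {v} → v ∈ ys → v ∈ xs) → xs ≡ ys
increasing-⊆-antisym {[]} {[]} _ _ _ _ = refl
increasing-⊆-antisym {[]} {_ ∷ _} _ _ _ ys⊆xs with () ← ys⊆xs (here refl)
increasing-⊆-antisym {_ ∷ _} {[]} _ _ xs⊆ys _ with () ← xs⊆ys (here refl)
increasing-⊆-antisym {x ∷ xs} {y ∷ ys} (x<xs ∷ inc-xs) (y<ys ∷ inc-ys) xs⊆ys ys⊆xs
  with refl ← ≤-antisym (∈-head-≤ x<xs (ys⊆xs (here refl))) (∈-head-≤ y<ys (xs⊆ys (here refl))) =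
  cong (x ∷_) (increasing-⊆-antisym inc-xs inc-ys
    (λ v∈xs → ∈-∷-above (All.lookup x<xs v∈xs) (xs⊆ys (there v∈xs)))
    (λ v∈ys → ∈-∷-above (All.lookup y<ys v∈ys) (ys⊆xs (there v∈ys))))

∈⇒≤max : ∀ {v} xs → v ∈ xs → v ≤ foldr _⊔_ 0 xs
∈⇒≤max (x ∷ xs) (here refl) = m≤m⊔n x _
∈⇒≤max (x ∷ xs) (there v∈xs) = ≤-trans (∈⇒≤max xs v∈xs) (m≤n⊔m x _)

max≤ : ∀ {m xs} → All (_≤ m) xs → foldr _⊔_ 0 xs ≤ m
max≤ [] = z≤n
max≤ (x≤m ∷ xs≤m) = ⊔-lub x≤m (max≤ xs≤m)

countᵇ-++ : ∀ v xs ys → countᵇ v (xs ++ ys) ≡ countᵇ v xs + countᵇ v ys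
countᵇ-++ v xs ys = trans (cong length (filter-++ (v ≟_) xs ys)) (length-++ (filter (v ≟_) xs))

countᵇ-↭ : ∀ v {xs ys} → xs ↭ ys → countᵇ v xs ≡ countᵇ v ys
countᵇ-↭ v = ↭-length ∘ filter-↭ (v ≟_)

∈⇒countᵇ-pos : ∀ {v xs} → v ∈ xs → 1 ≤ countᵇ v xs
∈⇒countᵇ-pos {v} = filter-some (v ≟_)

∉⇒countᵇ≡0 : ∀ {v} xs → v ∉ xs → countᵇ v xs ≡ 0
∉⇒countᵇ≡0 {v} xs v∉xs = cong length (filter-none (v ≟_) (¬Any⇒All¬ xs v∉xs))

countᵇ-pos⇒∈ : ∀ {v} xs → 1 ≤ countᵇ v xs → v ∈ xs
countᵇ-pos⇒∈ {v} xs pos with v ∈? xs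
... | yes v∈xs = v∈xs
... | no v∉xs = ⊥-elim (<⇒≢ pos (sym (∉⇒countᵇ≡0 xs v∉xs)))

countᵇ-increasing : ∀ {v xs} → Increasing xs → v ∈ xs → countᵇ v xs ≡ 1
countᵇ-increasing {v} {x ∷ xs} (x<xs ∷ _) (here refl) =
  trans (cong length (filter-accept (v ≟_) refl))
        (cong suc (∉⇒countᵇ≡0 xs (λ v∈xs → <-irrefl refl (All.lookup x<xs v∈xs))))
countᵇ-increasing {v} {x ∷ xs} (x<xs ∷ inc) (there v∈xs) =
  trans (cong length (filter-reject (v ≟_) (λ { refl → <-irrefl refl (All.lookup x<xs v∈xs) })))
        (countᵇ-increasing inc v∈xs)

m+n≡1⇒n≡0 : ∀ {m n} → 1 ≤ m → m + n ≡ 1 → n ≡ 0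
m+n≡1⇒n≡0 {suc m} _ eq = m+n≡0⇒n≡0 m (suc-injective eq)

length-filter-∁ : ∀ {P : ℕ → Set} (P? : Decidable P) xs →
                  length (filter (λ v → ¬? (P? v)) xs) + length (filter P? xs) ≡ length xs
length-filter-∁ P? [] = refl
length-filter-∁ P? (x ∷ xs) with P? x
... | yes _ = trans (+-suc _ _) (cong suc (length-filter-∁ P? xs))
... | no _ = cong suc (length-filter-∁ P? xs)

interval : ℕ → ℕ → List ℕ
interval s zero = []
interval s (suc n) = s ∷ interval (suc s) n

length-interval : ∀ s n → length (interval s n) ≡ n
length-interval s zero = refl
length-interval s (suc n) = cong suc (length-interval (suc s) n)

∈-interval⁻ : ∀ {v} s n → v ∈ interval s n → s ≤ v × v < s + n
∈-interval⁻ s (suc n) (here refl) = ≤-refl , m<m+n s (s≤s z≤n)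
∈-interval⁻ {v} s (suc n) (there v∈) =
  let s<v , v<s+n = ∈-interval⁻ (suc s) n v∈ in <⇒≤ s<v , subst (v <_) (sym (+-suc s n)) v<s+n

∈-interval⁺ : ∀ {v} s n → s ≤ v → v < s + n → v ∈ interval s n
∈-interval⁺ {v} s zero s≤v v<s = ⊥-elim (<-irrefl refl (≤-<-trans s≤v (subst (v <_) (+-identityʳ s) v<s)))
∈-interval⁺ {v} s (suc n) s≤v v<s+n with v ≟ s
... | yes refl = here refl
... | no v≢s = there (∈-interval⁺ (suc s) n (≤∧≢⇒< s≤v (v≢s ∘ sym)) (subst (v <_) (+-suc s n) v<s+n))

interval-increasing : ∀ s n → Increasing (interval s n)
interval-increasing s zero = []
interval-increasing s (suc n) =
  All.tabulate (proj₁ ∘ ∈-interval⁻ (suc s) n) ∷ interval-increasing (suc s) n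

interval-<-suc : ∀ s n → Pointwise _<_ (interval s n) (interval (suc s) n)
interval-<-suc s zero = []
interval-<-suc s (suc n) = ≤-refl ∷ interval-<-suc (suc s) n

interval≤increasing : ∀ s {xs} → Increasing xs → All (s ≤_) xs → Pointwise _≤_ (interval s (length xs)) xs
interval≤increasing s {[]} _ _ = []
interval≤increasing s {x ∷ xs} (x<xs ∷ inc) (s≤x ∷ _) =
  s≤x ∷ interval≤increasing (suc s) inc (All.map (≤-<-trans s≤x) x<xs)

increasing≤interval : ∀ s {xs} → Increasing xs → All (_≤ s + length xs) xs →
                      Pointwise _≤_ xs (interval (suc s) (length xs))
increasing≤interval s {[]} _ _ = []
increasing≤interval s {x ∷ []} _ (x≤s+1 ∷ []) = subst (x ≤_) (+-comm s 1) x≤s+1 ∷ []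
increasing≤interval s {x ∷ y ∷ xs} ((x<y ∷ _) ∷ inc) (_ ∷ bounds)
  with y≤ ∷ rest ← increasing≤interval (suc s) inc (All.map (λ {v} v≤ → subst (v ≤_) (+-suc s _) v≤) bounds) =
  ≤-pred (≤-trans x<y y≤) ∷ y≤ ∷ rest

interval-suc≤ : ∀ {s n ys} → Pointwise _<_ (interval s n) ys → Pointwise _≤_ (interval (suc s) n) ys
interval-suc≤ {n = zero} [] = []
interval-suc≤ {n = suc n} (s<y ∷ rest) = s<y ∷ interval-suc≤ rest

≤interval-pred : ∀ {s n xs} → Pointwise _<_ xs (interval (suc s) n) → Pointwise _≤_ xs (interval s n)
≤interval-pred {n = zero} [] = []
≤interval-pred {n = suc n} (x<s+1 ∷ rest) = ≤-pred x<s+1 ∷ ≤interval-pred rest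

record Correspondence {A B : Set} (P : A → Set) (Q : B → Set) : Set where
  field
    to         : A → B
    from       : B → A
    to-valid   : ∀ x → P x → Q (to x)
    from-valid : ∀ y → Q y → P (from y)
    from∘to    : ∀ x → P x → from (to x) ≡ x
    to∘from    : ∀ y → Q y → to (from y) ≡ y

module _ {A B C : Set} {P : A → Set} {Q : B → Set} {R : C → Set} where

  infixr 9 _⨾_

  _⨾_ : Correspondence P Q → Correspondence Q R → Correspondence P R
  f ⨾ g = record
    { to = G.to ∘ F.to
    ; from = F.from ∘ G.from
    ; to-valid = λ x → G.to-valid (F.to x) ∘ F.to-valid x
    ; from-valid = λ z → F.from-valid (G.from z) ∘ G.from-valid z
    ; from∘to = λ x p → trans (cong F.from (G.from∘to (F.to x) (F.to-valid x p))) (F.from∘to x p)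
    ; to∘from = λ z r → trans (cong G.to (F.to∘from (G.from z) (G.from-valid z r))) (G.to∘from z r) }
    where
    module F = Correspondence f
    module G = Correspondence g

Correspondence-sym : ∀ {A B : Set} {P : A → Set} {Q : B → Set} → Correspondence P Q → Correspondence Q P
Correspondence-sym f = record
  { to = from ; from = to ; to-valid = from-valid ; from-valid = to-valid ; from∘to = to∘from ; to∘from = from∘to }
  where open Correspondence f

Correspondence⇒↔ : ∀ {A B : Set} {P : A → Set} {Q : B → Set} →
                   (∀ {x} (p q : P x) → p ≡ q) → (∀ {y} (p q : Q y) → p ≡ q) →
                   Correspondence P Q → Σ A P ↔ Σ B Q
Correspondence⇒↔ P-irr Q-irr f = mk↔ₛ′
  (λ (x , p) → to x , to-valid x p) (λ (y , q) → from y , from-valid y q)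
  (λ (y , q) → Σ-≡ Q-irr (to∘from y q)) (λ (x , p) → Σ-≡ P-irr (from∘to x p))
  where
  open Correspondence f
  Σ-≡ : ∀ {X : Set} {S : X → Set} → (∀ {x} (p q : S x) → p ≡ q) →
        ∀ {x y} {p : S x} {q : S y} → x ≡ y → _≡_ {A = Σ X S} (x , p) (y , q)
  Σ-≡ irr {p = p} {q} refl = cong (_ ,_) (irr p q)

-- Rows with one gap

-- For t ≤ n, gapRow s t n lists {s, …, s + n} without s + t.
gapRow : ℕ → ℕ → ℕ → List ℕ
gapRow s zero n = interval (suc s) n
gapRow s (suc t) zero = []
gapRow s (suc t) (suc n) = s ∷ gapRow (suc s) t n

gapOf : ℕ → List ℕ → ℕ
gapOf s [] = 0
gapOf s (x ∷ xs) with x ≟ s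
... | yes _ = suc (gapOf (suc s) xs)
... | no _ = 0

InGapRow : ℕ → ℕ → ℕ → ℕ → Set
InGapRow s t n v = s ≤ v × v ≤ s + n × v ≢ s + t

length-gapRow : ∀ s t n → length (gapRow s t n) ≡ n
length-gapRow s zero n = length-interval (suc s) n
length-gapRow s (suc t) zero = refl
length-gapRow s (suc t) (suc n) = cong suc (length-gapRow (suc s) t n)

∈-gapRow⁻ : ∀ {v} s t n → v ∈ gapRow s t n → InGapRow s t n v
∈-gapRow⁻ {v} s zero n v∈ =
  let s<v , v<1+s+n = ∈-interval⁻ (suc s) n v∈
  in <⇒≤ s<v , ≤-pred v<1+s+n , λ v≡s+0 → <-irrefl (sym (trans v≡s+0 (+-identityʳ s))) s<v
∈-gapRow⁻ s (suc t) (suc n) (here refl) =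
  ≤-refl , m≤m+n s (suc n) , λ s≡s+1+t → m≢1+m+n s (trans s≡s+1+t (+-suc s t))
∈-gapRow⁻ {v} s (suc t) (suc n) (there v∈) =
  let s<v , v≤ , v≢ = ∈-gapRow⁻ (suc s) t n v∈
  in <⇒≤ s<v , subst (v ≤_) (sym (+-suc s n)) v≤ , λ v≡ → v≢ (trans v≡ (+-suc s t))

∈-gapRow⁺ : ∀ {v} s t n → t ≤ n → InGapRow s t n v → v ∈ gapRow s t n
∈-gapRow⁺ {v} s zero n _ (s≤v , v≤s+n , v≢s+0) =
  ∈-interval⁺ (suc s) n (≤∧≢⇒< s≤v (λ s≡v → v≢s+0 (trans (sym s≡v) (sym (+-identityʳ s))))) (s≤s v≤s+n)
∈-gapRow⁺ {v} s (suc t) (suc n) (s≤s t≤n) (s≤v , v≤s+1+n , v≢s+1+t) with v ≟ s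
... | yes refl = here refl
... | no v≢s = there (∈-gapRow⁺ (suc s) t n t≤n
  (≤∧≢⇒< s≤v (v≢s ∘ sym) , subst (v ≤_) (+-suc s n) v≤s+1+n , λ v≡ → v≢s+1+t (trans v≡ (sym (+-suc s t)))))

gapRow-increasing : ∀ s t n → Increasing (gapRow s t n)
gapRow-increasing s zero n = interval-increasing (suc s) n
gapRow-increasing s (suc t) zero = []
gapRow-increasing s (suc t) (suc n) =
  All.tabulate (proj₁ ∘ ∈-gapRow⁻ (suc s) t n) ∷ gapRow-increasing (suc s) t n

gapOf-gapRow : ∀ s t n → t ≤ n → gapOf s (gapRow s t n) ≡ t
gapOf-gapRow s zero zero _ = refl
gapOf-gapRow s zero (suc n) _ with suc s ≟ s
... | yes 1+s≡s = ⊥-elim (1+n≢n 1+s≡s)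
... | no _ = refl
gapOf-gapRow s (suc t) (suc n) (s≤s t≤n) with s ≟ s
... | yes _ = cong suc (gapOf-gapRow (suc s) t n t≤n)
... | no s≢s = ⊥-elim (s≢s refl)

gapRow-squeeze : ∀ s n {xs} → Increasing xs →
                 Pointwise _≤_ (interval s n) xs → Pointwise _≤_ xs (interval (suc s) n) →
                 gapOf s xs ≤ n × xs ≡ gapRow s (gapOf s xs) n
gapRow-squeeze s zero [] [] [] = z≤n , refl
gapRow-squeeze s (suc n) {x ∷ xs} (x<xs ∷ inc) (s≤x ∷ lower) (x≤1+s ∷ upper) with x ≟ s
... | yes refl = let gap≤n , xs≡ = gapRow-squeeze (suc x) n inc lower upper in s≤s gap≤n , cong (x ∷_) xs≡
... | no x≢s with refl ← ≤-antisym x≤1+s (≤∧≢⇒< s≤x (x≢s ∘ sym)) =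
  z≤n , cong (x ∷_) (Pointwise-≡⇒≡ (antisymmetric ≤-antisym upper above-x))
  where
  above-x : Pointwise _≤_ (interval (suc x) n) xs
  above-x = subst (λ m → Pointwise _≤_ (interval (suc x) m) xs)
                  (trans (Pointwise-length upper) (length-interval (suc x) n))
                  (interval≤increasing (suc x) inc x<xs)

gapRow-<-below : ∀ s t t′ n → t′ ≤ t → t ≤ n → Pointwise _<_ (gapRow s t n) (gapRow (suc s) t′ n)
gapRow-<-below s zero zero n _ _ = interval-<-suc (suc s) n
gapRow-<-below s (suc t) zero zero _ _ = []
gapRow-<-below s (suc t) (suc t′) zero _ _ = []
gapRow-<-below s (suc t) zero (suc n) _ (s≤s t≤n) = n≤1+n (suc s) ∷ gapRow-<-below (suc s) t zero n z≤n t≤n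
gapRow-<-below s (suc t) (suc t′) (suc n) (s≤s t′≤t) (s≤s t≤n) =
  ≤-refl ∷ gapRow-<-below (suc s) t t′ n t′≤t t≤n

gapRow-<-below⁻ : ∀ s t t′ n → t′ ≤ n → Pointwise _<_ (gapRow s t n) (gapRow (suc s) t′ n) → t′ ≤ t
gapRow-<-below⁻ s t zero n _ _ = z≤n
gapRow-<-below⁻ s zero (suc t′) (suc n) _ (1+s<1+s ∷ _) = ⊥-elim (<-irrefl refl 1+s<1+s)
gapRow-<-below⁻ s (suc t) (suc t′) (suc n) (s≤s t′≤n) (_ ∷ below) = s≤s (gapRow-<-below⁻ (suc s) t t′ n t′≤n below)

-- Packed increasing tableaux of shape 3 × k

Triple : Set
Triple = ℕ × ℕ × ℕ

gapTableau : ℕ → Triple → Filling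
gapTableau k (t₁ , t₂ , t₃) = gapRow 1 t₁ k ∷ gapRow 2 t₂ k ∷ gapRow 3 t₃ k ∷ []

gapsOf : Filling → Triple
gapsOf (r₁ ∷ r₂ ∷ r₃ ∷ _) = gapOf 1 r₁ , gapOf 2 r₂ , gapOf 3 r₃
gapsOf _ = 0 , 0 , 0

GapsBounded : ℕ → Triple → Set
GapsBounded k (t₁ , t₂ , t₃) = t₁ ≤ k × t₂ ≤ k × t₃ ≤ k

packedᵇ : ℕ → Filling → Bool
packedᵇ k F = isIncreasingᵇ (rect3 k) F ∧ isPackedᵇ F ∧ (maxEntry F ≡ᵇ 3 + k)

record PackedParts (k : ℕ) (F : Filling) : Set where
  field
    shape≡   : shape F ≡ rect3 k
    positive : ∀ {v} → v ∈ entries F → 1 ≤ v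
    rows     : All (T ∘ rowIncᵇ) F
    columns  : T (colsIncᵇ F)
    packed   : ∀ {v} → 1 ≤ v → v ≤ 3 + k → v ∈ entries F
    max≡     : maxEntry F ≡ 3 + k

packedᵇ⇒parts : ∀ k F → T (packedᵇ k F) → PackedParts k F
packedᵇ⇒parts k F h = record
  { shape≡ = eqListᵇ⇒≡ (shape F) (rect3 k) shape-ok
  ; positive = ≤ᵇ⇒≤ 1 _ ∘ all⇒∈ (1 ≤ᵇ_) positive-ok
  ; rows = all⁺ rowIncᵇ F rows-ok
  ; columns = columns-ok
  ; packed = λ 1≤v v≤ → occursᵇ⇒∈ (entries F)
      (all-oneTo⁻ (λ v → occursᵇ v E) (subst (T ∘ all (λ v → occursᵇ v E) ∘ oneTo) max≡ packed-ok) 1≤v v≤)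
  ; max≡ = max≡ }
  where
  E = entries F
  increasing-ok : T (isIncreasingᵇ (rect3 k) F)
  increasing-ok = proj₁ (T-∧⁻ (isIncreasingᵇ (rect3 k) F) h)
  packed-ok : T (isPackedᵇ F)
  packed-ok = proj₁ (T-∧⁻ (isPackedᵇ F) (proj₂ (T-∧⁻ (isIncreasingᵇ (rect3 k) F) h)))
  max-ok : T (maxEntry F ≡ᵇ 3 + k)
  max-ok = proj₂ (T-∧⁻ (isPackedᵇ F) (proj₂ (T-∧⁻ (isIncreasingᵇ (rect3 k) F) h)))
  shape-ok : T (eqListᵇ (shape F) (rect3 k))
  shape-ok = proj₁ (T-∧⁻ (eqListᵇ (shape F) (rect3 k)) increasing-ok)
  others : T (all (1 ≤ᵇ_) E ∧ all rowIncᵇ F ∧ colsIncᵇ F)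
  others = proj₂ (T-∧⁻ (eqListᵇ (shape F) (rect3 k)) increasing-ok)
  positive-ok : T (all (1 ≤ᵇ_) E)
  positive-ok = proj₁ (T-∧⁻ (all (1 ≤ᵇ_) E) others)
  rows-ok : T (all rowIncᵇ F)
  rows-ok = proj₁ (T-∧⁻ (all rowIncᵇ F) (proj₂ (T-∧⁻ (all (1 ≤ᵇ_) E) others)))
  columns-ok : T (colsIncᵇ F)
  columns-ok = proj₂ (T-∧⁻ (all rowIncᵇ F) (proj₂ (T-∧⁻ (all (1 ≤ᵇ_) E) others)))
  max≡ = ≡ᵇ⇒≡ (maxEntry F) (3 + k) max-ok

parts⇒packedᵇ : ∀ k F → PackedParts k F → T (packedᵇ k F)
parts⇒packedᵇ k F parts =
  T-∧⁺ (T-∧⁺ (subst (T ∘ eqListᵇ (shape F)) shape≡ (eqListᵇ-refl (shape F)))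
             (T-∧⁺ (∈⇒all (1 ≤ᵇ_) (≤⇒≤ᵇ ∘ positive)) (T-∧⁺ (all⁻ rowIncᵇ rows) columns)))
       (T-∧⁺ (subst (T ∘ all occurs ∘ oneTo) (sym max≡) (all-oneTo⁺ occurs (λ 1≤v v≤ → ∈⇒occursᵇ (packed 1≤v v≤))))
             (subst (λ m → T (m ≡ᵇ 3 + k)) (sym max≡) (≡⇒≡ᵇ (3 + k) (3 + k) refl)))
  where
  open PackedParts parts
  occurs : ℕ → Bool
  occurs v = occursᵇ v (entries F)

rect3-rows : ∀ {k} F → shape F ≡ rect3 k →
             ∃ λ r₁ → ∃ λ r₂ → ∃ λ r₃ → F ≡ r₁ ∷ r₂ ∷ r₃ ∷ [] × length r₁ ≡ k × length r₂ ≡ k × length r₃ ≡ k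
rect3-rows (r₁ ∷ r₂ ∷ r₃ ∷ []) eq
  with ℓ₁ , eq₁ ← ∷-injective eq with ℓ₂ , eq₂ ← ∷-injective eq₁ with ℓ₃ , _ ← ∷-injective eq₂ =
  r₁ , r₂ , r₃ , refl , ℓ₁ , ℓ₂ , ℓ₃

squeezed-rows : ∀ k {r₁ r₂ r₃} → Increasing r₁ → Increasing r₂ → Increasing r₃ →
                length r₁ ≡ k → length r₃ ≡ k → Pointwise _<_ r₁ r₂ → Pointwise _<_ r₂ r₃ →
                All (1 ≤_) r₁ → All (_≤ 3 + k) r₃ →
                GapsBounded k (gapsOf (r₁ ∷ r₂ ∷ r₃ ∷ [])) ×
                r₁ ∷ r₂ ∷ r₃ ∷ [] ≡ gapTableau k (gapsOf (r₁ ∷ r₂ ∷ r₃ ∷ []))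
squeezed-rows k {r₁} {r₂} {r₃} inc₁ inc₂ inc₃ refl ℓ₃ r₁<r₂ r₂<r₃ positive bounded =
  let t₁≤k , r₁≡ = gapRow-squeeze 1 k inc₁ lower₁ upper₁
      t₂≤k , r₂≡ = gapRow-squeeze 2 k inc₂ lower₂ upper₂
      t₃≤k , r₃≡ = gapRow-squeeze 3 k inc₃ lower₃ upper₃
  in (t₁≤k , t₂≤k , t₃≤k) , cong₂ _∷_ r₁≡ (cong₂ _∷_ r₂≡ (cong (_∷ []) r₃≡))
  where
  lower₁ : Pointwise _≤_ (interval 1 k) r₁
  lower₁ = interval≤increasing 1 inc₁ positive
  lower₂ = interval-suc≤ (transitive ≤-<-trans lower₁ r₁<r₂)
  lower₃ = interval-suc≤ (transitive ≤-<-trans lower₂ r₂<r₃)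
  upper₃ : Pointwise _≤_ r₃ (interval 4 k)
  upper₃ = subst (Pointwise _≤_ r₃ ∘ interval 4) ℓ₃
             (increasing≤interval 3 inc₃ (subst (λ m → All (_≤ 3 + m) r₃) (sym ℓ₃) bounded))
  upper₂ = ≤interval-pred (transitive <-≤-trans r₂<r₃ upper₃)
  upper₁ = ≤interval-pred (transitive <-≤-trans r₁<r₂ upper₂)

packed⇒gapTableau : ∀ k F → T (packedᵇ k F) → GapsBounded k (gapsOf F) × F ≡ gapTableau k (gapsOf F)
packed⇒gapTableau k F h
  with parts ← packedᵇ⇒parts k F h
  with r₁ , r₂ , r₃ , refl , ℓ₁ , ℓ₂ , ℓ₃ ← rect3-rows F (PackedParts.shape≡ parts)
  with inc₁ ∷ inc₂ ∷ inc₃ ∷ [] ← PackedParts.rows parts =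
  squeezed-rows k (rowIncᵇ⇒increasing r₁ inc₁) (rowIncᵇ⇒increasing r₂ inc₂) (rowIncᵇ⇒increasing r₃ inc₃)
    ℓ₁ ℓ₃ (colIncᵇ⇒Pointwise r₁ r₂ (trans ℓ₁ (sym ℓ₂)) c₁₂) (colIncᵇ⇒Pointwise r₂ r₃ (trans ℓ₂ (sym ℓ₃)) c₂₃)
    (All.tabulate (positive ∘ ∈-++⁺ˡ))
    (All.tabulate (λ v∈r₃ → subst (_ ≤_) max≡ (∈⇒≤max (entries F) (∈-++⁺ʳ r₁ (∈-++⁺ʳ r₂ (∈-++⁺ˡ v∈r₃))))))
  where
  open PackedParts parts
  c₁₂ = proj₁ (T-∧⁻ (colIncᵇ r₁ r₂) columns)
  c₂₃ = proj₁ (T-∧⁻ (colIncᵇ r₂ r₃) (proj₂ (T-∧⁻ (colIncᵇ r₁ r₂) columns)))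

InSomeRow : ℕ → Triple → ℕ → Set
InSomeRow k (t₁ , t₂ , t₃) v = InGapRow 1 t₁ k v ⊎ InGapRow 2 t₂ k v ⊎ InGapRow 3 t₃ k v

∈-gapTableau⁻ : ∀ k t₁ t₂ t₃ {v} → v ∈ entries (gapTableau k (t₁ , t₂ , t₃)) → InSomeRow k (t₁ , t₂ , t₃) v
∈-gapTableau⁻ k t₁ t₂ t₃ v∈ with ∈-++⁻ (gapRow 1 t₁ k) v∈
... | inj₁ v∈r₁ = inj₁ (∈-gapRow⁻ 1 t₁ k v∈r₁)
... | inj₂ v∈ with ∈-++⁻ (gapRow 2 t₂ k) v∈
...   | inj₁ v∈r₂ = inj₂ (inj₁ (∈-gapRow⁻ 2 t₂ k v∈r₂))
...   | inj₂ v∈ with ∈-++⁻ (gapRow 3 t₃ k) v∈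
...     | inj₁ v∈r₃ = inj₂ (inj₂ (∈-gapRow⁻ 3 t₃ k v∈r₃))

∈-gapTableau⁺ : ∀ k t₁ t₂ t₃ {v} → GapsBounded k (t₁ , t₂ , t₃) → InSomeRow k (t₁ , t₂ , t₃) v →
                v ∈ entries (gapTableau k (t₁ , t₂ , t₃))
∈-gapTableau⁺ k t₁ t₂ t₃ (t₁≤k , _ , _) (inj₁ v∈r₁) = ∈-++⁺ˡ (∈-gapRow⁺ 1 t₁ k t₁≤k v∈r₁)
∈-gapTableau⁺ k t₁ t₂ t₃ (_ , t₂≤k , _) (inj₂ (inj₁ v∈r₂)) =
  ∈-++⁺ʳ (gapRow 1 t₁ k) (∈-++⁺ˡ (∈-gapRow⁺ 2 t₂ k t₂≤k v∈r₂))
∈-gapTableau⁺ k t₁ t₂ t₃ (_ , _ , t₃≤k) (inj₂ (inj₂ v∈r₃)) =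
  ∈-++⁺ʳ (gapRow 1 t₁ k) (∈-++⁺ʳ (gapRow 2 t₂ k) (∈-++⁺ˡ (∈-gapRow⁺ 3 t₃ k t₃≤k v∈r₃)))

InSomeRow-bounds : ∀ k t {v} → InSomeRow k t v → 1 ≤ v × v ≤ 3 + k
InSomeRow-bounds k _ (inj₁ (1≤v , v≤ , _)) = 1≤v , ≤-trans v≤ (+-monoˡ-≤ k (s≤s z≤n))
InSomeRow-bounds k _ (inj₂ (inj₁ (2≤v , v≤ , _))) = ≤-trans (s≤s z≤n) 2≤v , ≤-trans v≤ (n≤1+n (2 + k))
InSomeRow-bounds k _ (inj₂ (inj₂ (3≤v , v≤ , _))) = ≤-trans (s≤s z≤n) 3≤v , v≤

maxEntry-gapTableau : ∀ k t₁ t₂ t₃ → t₁ ≤ k → t₂ ≤ k → t₃ < k → maxEntry (gapTableau k (t₁ , t₂ , t₃)) ≡ 3 + k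
maxEntry-gapTableau k t₁ t₂ t₃ t₁≤k t₂≤k t₃<k = ≤-antisym
  (max≤ (All.tabulate (proj₂ ∘ InSomeRow-bounds k _ ∘ ∈-gapTableau⁻ k t₁ t₂ t₃)))
  (∈⇒≤max _ (∈-gapTableau⁺ k t₁ t₂ t₃ (t₁≤k , t₂≤k , <⇒≤ t₃<k)
    (inj₂ (inj₂ (m≤m+n 3 k , ≤-refl , λ 3+k≡3+t₃ → <-irrefl (sym (+-cancelˡ-≡ 3 _ _ 3+k≡3+t₃)) t₃<k)))))

-- The maximum 3 + k can only sit in row 3, which contains it unless t₃ = k.
maxEntry-gapTableau⁻ : ∀ k t₁ t₂ t₃ → t₃ ≤ k → maxEntry (gapTableau k (t₁ , t₂ , t₃)) ≡ 3 + k → t₃ < k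
maxEntry-gapTableau⁻ k t₁ t₂ t₃ t₃≤k max≡ with foldr-selective ⊔-sel 0 (entries (gapTableau k (t₁ , t₂ , t₃)))
... | inj₁ max≡0 = ⊥-elim (0≢1+n (trans (sym max≡0) max≡))
... | inj₂ max∈ with ∈-gapTableau⁻ k t₁ t₂ t₃ (subst (_∈ entries (gapTableau k (t₁ , t₂ , t₃))) max≡ max∈)
...   | inj₁ (_ , 3+k≤1+k , _) = ⊥-elim (<-irrefl refl (≤-trans 3+k≤1+k (n≤1+n _)))
...   | inj₂ (inj₁ (_ , 3+k≤2+k , _)) = ⊥-elim (<-irrefl refl 3+k≤2+k)
...   | inj₂ (inj₂ (_ , _ , 3+k≢3+t₃)) = ≤∧≢⇒< t₃≤k (λ t₃≡k → 3+k≢3+t₃ (cong (3 +_) (sym t₃≡k)))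

gapsOf-gapTableau : ∀ k t → GapsBounded k t → gapsOf (gapTableau k t) ≡ t
gapsOf-gapTableau k (t₁ , t₂ , t₃) (t₁≤k , t₂≤k , t₃≤k) =
  cong₂ _,_ (gapOf-gapRow 1 t₁ k t₁≤k) (cong₂ _,_ (gapOf-gapRow 2 t₂ k t₂≤k) (gapOf-gapRow 3 t₃ k t₃≤k))

-- t₃ < k keeps the maximum 3 + k in row 3; the `has-` fields say that the values 1, 2, 3 + t₃
-- and 2 + k, each excluded from some row, still occur in another.
record Admissible (k t₁ t₂ t₃ : ℕ) : Set where
  field
    t₁≤k     : t₁ ≤ k
    t₂≤t₁    : t₂ ≤ t₁
    t₃≤t₂    : t₃ ≤ t₂
    t₃<k     : t₃ < k
    has-1    : t₁ ≢ 0
    has-2    : ¬ (t₁ ≡ 1 × t₂ ≡ 0)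
    has-3+t₃ : ¬ (t₁ ≡ suc t₂ × t₂ ≡ suc t₃ × 2 + t₃ ≤ k)
    has-2+k  : ¬ (t₂ ≡ k × suc t₃ ≡ k)

AdmissibleGaps : ℕ → Triple → Set
AdmissibleGaps k (t₁ , t₂ , t₃) = Admissible k t₁ t₂ t₃

admissible⇒bounded : ∀ {k} t → AdmissibleGaps k t → GapsBounded k t
admissible⇒bounded _ adm = t₁≤k , ≤-trans t₂≤t₁ t₁≤k , ≤-trans t₃≤t₂ (≤-trans t₂≤t₁ t₁≤k)
  where open Admissible adm

-- Row 3 holds every value from 3 to 3 + k but 3 + t₃, and rows 1 and 2 supply the rest.
admissible-covers : ∀ {k t₁ t₂ t₃} → 2 ≤ k → Admissible k t₁ t₂ t₃ →
                    ∀ v → 1 ≤ v → v ≤ 3 + k → InSomeRow k (t₁ , t₂ , t₃) v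
admissible-covers {k} {t₁} {t₂} {t₃} 2≤k adm v 1≤v v≤3+k = cover v 1≤v v≤3+k
  where
  open Admissible adm
  cover : ∀ v → 1 ≤ v → v ≤ 3 + k → InSomeRow k (t₁ , t₂ , t₃) v
  cover 1 _ _ = inj₁ (≤-refl , s≤s z≤n , λ 1≡1+t₁ → has-1 (sym (suc-injective 1≡1+t₁)))
  cover 2 _ _ with t₁ ≟ 1
  ... | no t₁≢1 = inj₁ (s≤s z≤n , s≤s (≤-trans (s≤s z≤n) 2≤k) , λ 2≡1+t₁ → t₁≢1 (sym (suc-injective 2≡1+t₁)))
  ... | yes t₁≡1 = inj₂ (inj₁ (≤-refl , s≤s (s≤s z≤n) , λ 2≡2+t₂ → has-2 (t₁≡1 , sym (+-cancelˡ-≡ 2 _ _ 2≡2+t₂))))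
  cover (suc (suc (suc w))) _ v≤3+k with w ≟ t₃
  ... | no w≢t₃ = inj₂ (inj₂ (s≤s (s≤s (s≤s z≤n)) , v≤3+k , w≢t₃ ∘ +-cancelˡ-≡ 3 _ _))
  ... | yes refl with 3 + w ≤? 1 + k
  ...   | yes 3+w≤1+k with 2 + w ≟ t₁
  ...     | no 2+w≢t₁ = inj₁ (s≤s z≤n , 3+w≤1+k , 2+w≢t₁ ∘ suc-injective)
  ...     | yes 2+w≡t₁ with 1 + w ≟ t₂
  ...       | no 1+w≢t₂ = inj₂ (inj₁ (s≤s (s≤s z≤n) , ≤-trans 3+w≤1+k (n≤1+n _) , 1+w≢t₂ ∘ +-cancelˡ-≡ 2 _ _))
  ...       | yes 1+w≡t₂ = ⊥-elim (has-3+t₃ (trans (sym 2+w≡t₁) (cong suc 1+w≡t₂) , sym 1+w≡t₂ , ≤-pred 3+w≤1+k))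
  cover (suc (suc (suc w))) _ v≤3+k | yes refl | no 3+w≰1+k with 1 + w ≟ t₂
  ... | no 1+w≢t₂ = inj₂ (inj₁ (s≤s (s≤s z≤n) , s≤s (s≤s t₃<k) , 1+w≢t₂ ∘ +-cancelˡ-≡ 2 _ _))
  ... | yes 1+w≡t₂ = ⊥-elim (has-2+k (trans (sym 1+w≡t₂) 1+w≡k , 1+w≡k))
    where
    1+w≡k : 1 + w ≡ k
    1+w≡k = ≤-antisym t₃<k (≤-pred (≤-pred (≰⇒> 3+w≰1+k)))

gapTableau-packed : ∀ k t → 2 ≤ k → AdmissibleGaps k t → T (packedᵇ k (gapTableau k t))
gapTableau-packed k (t₁ , t₂ , t₃) 2≤k adm = parts⇒packedᵇ k (gapTableau k (t₁ , t₂ , t₃)) record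
  { shape≡ = cong₂ _∷_ (length-gapRow 1 t₁ k) (cong₂ _∷_ (length-gapRow 2 t₂ k) (cong (_∷ []) (length-gapRow 3 t₃ k)))
  ; positive = proj₁ ∘ InSomeRow-bounds k _ ∘ ∈-gapTableau⁻ k t₁ t₂ t₃
  ; rows = increasing⇒rowIncᵇ (gapRow-increasing 1 t₁ k) ∷ increasing⇒rowIncᵇ (gapRow-increasing 2 t₂ k)
         ∷ increasing⇒rowIncᵇ (gapRow-increasing 3 t₃ k) ∷ []
  ; columns = T-∧⁺ (Pointwise⇒colIncᵇ (gapRow-<-below 1 t₁ t₂ k t₂≤t₁ t₁≤k))
                   (T-∧⁺ (Pointwise⇒colIncᵇ (gapRow-<-below 2 t₂ t₃ k t₃≤t₂ t₂≤k)) _)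
  ; packed = λ {v} 1≤v v≤ → ∈-gapTableau⁺ k t₁ t₂ t₃ bounded (admissible-covers 2≤k adm v 1≤v v≤)
  ; max≡ = maxEntry-gapTableau k t₁ t₂ t₃ t₁≤k t₂≤k t₃<k }
  where
  open Admissible adm
  bounded = admissible⇒bounded (t₁ , t₂ , t₃) adm
  t₂≤k = proj₁ (proj₂ bounded)

packed⇒admissible : ∀ k t → GapsBounded k t → T (packedᵇ k (gapTableau k t)) → AdmissibleGaps k t
packed⇒admissible k (t₁ , t₂ , t₃) (t₁≤k , t₂≤k , t₃≤k) h = record
  { t₁≤k = t₁≤k
  ; t₂≤t₁ = gapRow-<-below⁻ 1 t₁ t₂ k t₂≤k (colIncᵇ⇒Pointwise r₁ r₂ (same-length 1 t₁ 2 t₂) c₁₂)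
  ; t₃≤t₂ = gapRow-<-below⁻ 2 t₂ t₃ k t₃≤k (colIncᵇ⇒Pointwise r₂ r₃ (same-length 2 t₂ 3 t₃) c₂₃)
  ; t₃<k = maxEntry-gapTableau⁻ k t₁ t₂ t₃ t₃≤k max≡
  ; has-1 = λ t₁≡0 → no-1 t₁≡0 (occurs 1 (s≤s z≤n) (s≤s z≤n))
  ; has-2 = λ (t₁≡1 , t₂≡0) → no-2 t₁≡1 t₂≡0 (occurs 2 (s≤s z≤n) (s≤s (s≤s z≤n)))
  ; has-3+t₃ = λ (t₁≡ , t₂≡ , _) → no-3+t₃ t₁≡ t₂≡ (occurs (3 + t₃) (s≤s z≤n) (+-monoʳ-≤ 3 t₃≤k))
  ; has-2+k = λ (t₂≡k , 1+t₃≡k) → no-2+k t₂≡k 1+t₃≡k (occurs (2 + k) (s≤s z≤n) (n≤1+n _)) }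
  where
  open PackedParts (packedᵇ⇒parts k (gapTableau k (t₁ , t₂ , t₃)) h)
  r₁ = gapRow 1 t₁ k
  r₂ = gapRow 2 t₂ k
  r₃ = gapRow 3 t₃ k
  same-length : ∀ s t s′ t′ → length (gapRow s t k) ≡ length (gapRow s′ t′ k)
  same-length s t s′ t′ = trans (length-gapRow s t k) (sym (length-gapRow s′ t′ k))
  c₁₂ = proj₁ (T-∧⁻ (colIncᵇ r₁ r₂) columns)
  c₂₃ = proj₁ (T-∧⁻ (colIncᵇ r₂ r₃) (proj₂ (T-∧⁻ (colIncᵇ r₁ r₂) columns)))
  occurs : ∀ v → 1 ≤ v → v ≤ 3 + k → InSomeRow k (t₁ , t₂ , t₃) v
  occurs v 1≤v v≤ = ∈-gapTableau⁻ k t₁ t₂ t₃ (packed 1≤v v≤)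
  no-1 : t₁ ≡ 0 → ¬ InSomeRow k (t₁ , t₂ , t₃) 1
  no-1 t₁≡0 (inj₁ (_ , _ , 1≢1+t₁)) = 1≢1+t₁ (cong suc (sym t₁≡0))
  no-1 _ (inj₂ (inj₁ (s≤s () , _)))
  no-1 _ (inj₂ (inj₂ (s≤s () , _)))
  no-2 : t₁ ≡ 1 → t₂ ≡ 0 → ¬ InSomeRow k (t₁ , t₂ , t₃) 2
  no-2 t₁≡1 _ (inj₁ (_ , _ , 2≢1+t₁)) = 2≢1+t₁ (cong suc (sym t₁≡1))
  no-2 _ t₂≡0 (inj₂ (inj₁ (_ , _ , 2≢2+t₂))) = 2≢2+t₂ (cong (2 +_) (sym t₂≡0))
  no-2 _ _ (inj₂ (inj₂ (s≤s (s≤s ()) , _)))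
  no-3+t₃ : t₁ ≡ suc t₂ → t₂ ≡ suc t₃ → ¬ InSomeRow k (t₁ , t₂ , t₃) (3 + t₃)
  no-3+t₃ t₁≡ t₂≡ (inj₁ (_ , _ , ≢1+t₁)) = ≢1+t₁ (cong suc (sym (trans t₁≡ (cong suc t₂≡))))
  no-3+t₃ _ t₂≡ (inj₂ (inj₁ (_ , _ , ≢2+t₂))) = ≢2+t₂ (cong (2 +_) (sym t₂≡))
  no-3+t₃ _ _ (inj₂ (inj₂ (_ , _ , ≢3+t₃))) = ≢3+t₃ refl
  no-2+k : t₂ ≡ k → suc t₃ ≡ k → ¬ InSomeRow k (t₁ , t₂ , t₃) (2 + k)
  no-2+k _ _ (inj₁ (_ , 2+k≤1+k , _)) = <-irrefl refl (≤-pred 2+k≤1+k)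
  no-2+k t₂≡k _ (inj₂ (inj₁ (_ , _ , ≢2+t₂))) = ≢2+t₂ (cong (2 +_) (sym t₂≡k))
  no-2+k _ 1+t₃≡k (inj₂ (inj₂ (_ , _ , ≢3+t₃))) = ≢3+t₃ (cong (2 +_) (sym 1+t₃≡k))

packed⇄gaps : ∀ k → 2 ≤ k → Correspondence (T ∘ packedᵇ k) (AdmissibleGaps k)
packed⇄gaps k 2≤k = record
  { to = gapsOf
  ; from = gapTableau k
  ; to-valid = λ F h → let bounded , F≡ = packed⇒gapTableau k F h in
      packed⇒admissible k (gapsOf F) bounded (subst (T ∘ packedᵇ k) F≡ h)
  ; from-valid = λ t → gapTableau-packed k t 2≤k
  ; from∘to = λ F h → sym (proj₂ (packed⇒gapTableau k F h))
  ; to∘from = λ t → gapsOf-gapTableau k t ∘ admissible⇒bounded t }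

-- Standard tableaux of shape (2³, 1^(k-2))

twoColumnTableau : List ℕ → Triple → Filling
twoColumnTableau (x₁ ∷ x₂ ∷ x₃ ∷ xs) (a , b , c) = (x₁ ∷ a ∷ []) ∷ (x₂ ∷ b ∷ []) ∷ (x₃ ∷ c ∷ []) ∷ map [_] xs
twoColumnTableau _ _ = []

secondColumn : Filling → Triple
secondColumn ((_ ∷ a ∷ _) ∷ (_ ∷ b ∷ _) ∷ (_ ∷ c ∷ _) ∷ _) = a , b , c
secondColumn _ = 0 , 0 , 0

listOf : Triple → List ℕ
listOf (a , b , c) = a ∷ b ∷ c ∷ []

complement : ℕ → Triple → List ℕ
complement N t = filter (λ v → ¬? (v ∈? listOf t)) (interval 1 N)

listOf-increasing : ∀ {a b c} → a < b → b < c → Increasing (listOf (a , b , c))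
listOf-increasing a<b b<c = (a<b ∷ <-trans a<b b<c ∷ []) ∷ (b<c ∷ []) ∷ [] ∷ []

listOf-range : ∀ {N a b c v} → 1 ≤ a → a < b → b < c → c ≤ N → v ∈ listOf (a , b , c) → 1 ≤ v × v ≤ N
listOf-range 1≤a a<b b<c c≤N (here refl) = 1≤a , ≤-trans (<⇒≤ (<-trans a<b b<c)) c≤N
listOf-range 1≤a a<b b<c c≤N (there (here refl)) = ≤-trans 1≤a (<⇒≤ a<b) , ≤-trans (<⇒≤ b<c) c≤N
listOf-range 1≤a a<b b<c c≤N (there (there (here refl))) = ≤-trans 1≤a (<⇒≤ (<-trans a<b b<c)) , c≤N

sytTableau : ℕ → Triple → Filling
sytTableau k t = twoColumnTableau (complement (4 + k) t) t

record SYTParts (λ′ : Partition) (N : ℕ) (F : Filling) : Set where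
  field
    shape≡   : shape F ≡ λ′
    rows     : All (T ∘ rowIncᵇ) F
    columns  : T (colsIncᵇ F)
    in-range : ∀ {v} → v ∈ entries F → 1 ≤ v × v ≤ N
    once     : ∀ {v} → 1 ≤ v → v ≤ N → countᵇ v (entries F) ≡ 1

sytᵇ⇒parts : ∀ {λ′ N} F → sum λ′ ≡ N → T (isSYTᵇ λ′ F) → SYTParts λ′ N F
sytᵇ⇒parts {λ′} F refl h = record
  { shape≡ = eqListᵇ⇒≡ (shape F) λ′ shape-ok
  ; rows = all⁺ rowIncᵇ F rows-ok
  ; columns = columns-ok
  ; in-range = λ {v} v∈ → let 1≤v , v≤N = T-∧⁻ (1 ≤ᵇ v) (all⇒∈ in-range? range-ok v∈) in ≤ᵇ⇒≤ 1 v 1≤v , ≤ᵇ⇒≤ v _ v≤N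
  ; once = λ 1≤v v≤N → ≡ᵇ⇒≡ _ 1 (all-oneTo⁻ once? once-ok 1≤v v≤N) }
  where
  in-range? once? : ℕ → Bool
  in-range? x = (1 ≤ᵇ x) ∧ (x ≤ᵇ sum λ′)
  once? v = countᵇ v (entries F) ≡ᵇ 1
  shape-ok = proj₁ (T-∧⁻ (eqListᵇ (shape F) λ′) h)
  rest₁ = proj₂ (T-∧⁻ (eqListᵇ (shape F) λ′) h)
  rows-ok = proj₁ (T-∧⁻ (all rowIncᵇ F) rest₁)
  rest₂ = proj₂ (T-∧⁻ (all rowIncᵇ F) rest₁)
  columns-ok = proj₁ (T-∧⁻ (colsIncᵇ F) rest₂)
  rest₃ = proj₂ (T-∧⁻ (colsIncᵇ F) rest₂)
  range-ok = proj₁ (T-∧⁻ (all in-range? (entries F)) rest₃)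
  once-ok = proj₂ (T-∧⁻ (all in-range? (entries F)) rest₃)

parts⇒sytᵇ : ∀ {λ′ N} F → sum λ′ ≡ N → SYTParts λ′ N F → T (isSYTᵇ λ′ F)
parts⇒sytᵇ {λ′} F refl parts =
  T-∧⁺ (subst (T ∘ eqListᵇ (shape F)) shape≡ (eqListᵇ-refl (shape F)))
       (T-∧⁺ (all⁻ rowIncᵇ rows)
             (T-∧⁺ columns
                   (T-∧⁺ (∈⇒all in-range? (λ v∈ → let 1≤v , v≤N = in-range v∈ in T-∧⁺ (≤⇒≤ᵇ 1≤v) (≤⇒≤ᵇ v≤N)))
                         (all-oneTo⁺ once? (λ 1≤v v≤N → ≡⇒≡ᵇ _ 1 (once 1≤v v≤N))))))
  where
  open SYTParts parts
  in-range? once? : ℕ → Bool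
  in-range? x = (1 ≤ᵇ x) ∧ (x ≤ᵇ sum λ′)
  once? v = countᵇ v (entries F) ≡ᵇ 1

sum-hook2³1 : ∀ k′ → sum (hook2³1 (2 + k′)) ≡ 4 + (2 + k′)
sum-hook2³1 k′ = cong (6 +_) (sum-replicate-1 k′)
  where
  sum-replicate-1 : ∀ n → sum (replicate n 1) ≡ n
  sum-replicate-1 zero = refl
  sum-replicate-1 (suc n) = cong suc (sum-replicate-1 n)

length-singletons : ∀ (xs : List ℕ) → map length (map [_] xs) ≡ replicate (length xs) 1
length-singletons [] = refl
length-singletons (x ∷ xs) = cong (1 ∷_) (length-singletons xs)

singletons : ∀ (R : Filling) n → map length R ≡ replicate n 1 → ∃ λ xs → R ≡ map [_] xs × length xs ≡ n
singletons [] zero _ = [] , refl , refl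
singletons ((x ∷ []) ∷ R) (suc n) eq with xs , refl , refl ← singletons R n (proj₂ (∷-injective eq)) =
  x ∷ xs , refl , refl

singleton-rows : ∀ xs → All (T ∘ rowIncᵇ) (map [_] xs)
singleton-rows [] = []
singleton-rows (x ∷ xs) = _ ∷ singleton-rows xs

colsIncᵇ-singletons⁻ : ∀ x ys xs → T (colsIncᵇ ((x ∷ ys) ∷ map [_] xs)) → Linked _<_ (x ∷ xs)
colsIncᵇ-singletons⁻ x ys [] _ = [-]
colsIncᵇ-singletons⁻ x [] (y ∷ xs) h =
  let x<y , rest = T-∧⁻ ((x <ᵇ y) ∧ _) h in <ᵇ⇒< x y (proj₁ (T-∧⁻ (x <ᵇ y) x<y)) ∷ colsIncᵇ-singletons⁻ y [] xs rest
colsIncᵇ-singletons⁻ x (_ ∷ _) (y ∷ xs) h =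
  let x<y , rest = T-∧⁻ ((x <ᵇ y) ∧ _) h in <ᵇ⇒< x y (proj₁ (T-∧⁻ (x <ᵇ y) x<y)) ∷ colsIncᵇ-singletons⁻ y [] xs rest

colsIncᵇ-singletons⁺ : ∀ x ys {xs} → Linked _<_ (x ∷ xs) → T (colsIncᵇ ((x ∷ ys) ∷ map [_] xs))
colsIncᵇ-singletons⁺ x ys [-] = _
colsIncᵇ-singletons⁺ x [] {y ∷ _} (x<y ∷ rest) = T-∧⁺ (T-∧⁺ (<⇒<ᵇ x<y) _) (colsIncᵇ-singletons⁺ y [] rest)
colsIncᵇ-singletons⁺ x (_ ∷ _) {y ∷ _} (x<y ∷ rest) = T-∧⁺ (T-∧⁺ (<⇒<ᵇ x<y) _) (colsIncᵇ-singletons⁺ y [] rest)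

twoColumnTableau-↭ : ∀ x₁ x₂ x₃ xs t →
                     entries (twoColumnTableau (x₁ ∷ x₂ ∷ x₃ ∷ xs) t) ↭ (x₁ ∷ x₂ ∷ x₃ ∷ xs) ++ listOf t
twoColumnTableau-↭ x₁ x₂ x₃ xs (a , b , c) =
  prep x₁ (↭-trans (swap a x₂ (↭-reflexive refl))
    (prep x₂ (↭-trans (shifts (a ∷ b ∷ []) [ x₃ ])
      (prep x₃ (↭-trans (↭-reflexive (cong (λ ys → a ∷ b ∷ c ∷ ys) (concat-map-[_] xs)))
                        (++-comm (a ∷ b ∷ c ∷ []) xs))))))

countᵇ-twoColumnTableau : ∀ v x₁ x₂ x₃ xs t →
  countᵇ v (entries (twoColumnTableau (x₁ ∷ x₂ ∷ x₃ ∷ xs) t)) ≡ countᵇ v (x₁ ∷ x₂ ∷ x₃ ∷ xs) + countᵇ v (listOf t)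
countᵇ-twoColumnTableau v x₁ x₂ x₃ xs t =
  trans (countᵇ-↭ v (twoColumnTableau-↭ x₁ x₂ x₃ xs t)) (countᵇ-++ v (x₁ ∷ x₂ ∷ x₃ ∷ xs) (listOf t))

∈-twoColumnTableau⁻ : ∀ {v} x₁ x₂ x₃ xs t → v ∈ entries (twoColumnTableau (x₁ ∷ x₂ ∷ x₃ ∷ xs) t) →
                      v ∈ x₁ ∷ x₂ ∷ x₃ ∷ xs ⊎ v ∈ listOf t
∈-twoColumnTableau⁻ x₁ x₂ x₃ xs t = ∈-++⁻ (x₁ ∷ x₂ ∷ x₃ ∷ xs) ∘ ∈-resp-↭ (twoColumnTableau-↭ x₁ x₂ x₃ xs t)

∈-twoColumnTableau⁺ : ∀ {v} x₁ x₂ x₃ xs t → v ∈ x₁ ∷ x₂ ∷ x₃ ∷ xs ⊎ v ∈ listOf t →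
                      v ∈ entries (twoColumnTableau (x₁ ∷ x₂ ∷ x₃ ∷ xs) t)
∈-twoColumnTableau⁺ x₁ x₂ x₃ xs t v∈ = ∈-resp-↭ (↭-sym (twoColumnTableau-↭ x₁ x₂ x₃ xs t)) (∈-++⁺ v∈)
  where
  ∈-++⁺ : ∀ {v} → v ∈ x₁ ∷ x₂ ∷ x₃ ∷ xs ⊎ v ∈ listOf t → v ∈ (x₁ ∷ x₂ ∷ x₃ ∷ xs) ++ listOf t
  ∈-++⁺ (inj₁ v∈X) = ∈-++⁺ˡ v∈X
  ∈-++⁺ (inj₂ v∈t) = ∈-++⁺ʳ (x₁ ∷ x₂ ∷ x₃ ∷ xs) v∈t

∈-complement⁻ : ∀ {v} N t → v ∈ complement N t → (1 ≤ v × v ≤ N) × v ∉ listOf t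
∈-complement⁻ N t v∈ =
  let v∈interval , v∉t = ∈-filter⁻ (λ v → ¬? (v ∈? listOf t)) v∈
      1≤v , v<1+N = ∈-interval⁻ 1 N v∈interval
  in (1≤v , ≤-pred v<1+N) , v∉t

∈-complement⁺ : ∀ {v} N t → 1 ≤ v → v ≤ N → v ∉ listOf t → v ∈ complement N t
∈-complement⁺ N t 1≤v v≤N = ∈-filter⁺ (λ v → ¬? (v ∈? listOf t)) (∈-interval⁺ 1 N 1≤v (s≤s v≤N))

complement-increasing : ∀ N t → Increasing (complement N t)
complement-increasing N t = AllPairs.filter⁺ (λ v → ¬? (v ∈? listOf t)) (interval-increasing 1 N)

countᵇ-complement : ∀ {v} N t → Increasing (listOf t) → 1 ≤ v → v ≤ N →
                    countᵇ v (complement N t) + countᵇ v (listOf t) ≡ 1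
countᵇ-complement {v} N t inc 1≤v v≤N with v ∈? listOf t
... | yes v∈t = cong₂ _+_ (∉⇒countᵇ≡0 _ (λ v∈ → proj₂ (∈-complement⁻ N t v∈) v∈t)) (countᵇ-increasing inc v∈t)
... | no v∉t = trans (cong₂ _+_ (countᵇ-increasing (complement-increasing N t) (∈-complement⁺ N t 1≤v v≤N v∉t))
                                (∉⇒countᵇ≡0 _ v∉t))
                     (+-identityʳ 1)

complement-unique : ∀ N t {X} → Increasing X → (∀ {v} → v ∈ X → 1 ≤ v × v ≤ N) →
                    (∀ {v} → 1 ≤ v → v ≤ N → countᵇ v X + countᵇ v (listOf t) ≡ 1) → X ≡ complement N t
complement-unique N t {X} inc range once =
  increasing-⊆-antisym inc (complement-increasing N t)
    (λ v∈X → let 1≤v , v≤N = range v∈X in ∈-complement⁺ N t 1≤v v≤N (∈X⇒∉t v∈X))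
    (λ v∈ → let (1≤v , v≤N) , v∉t = ∈-complement⁻ N t v∈ in
       countᵇ-pos⇒∈ X (≤-reflexive (sym (trans (sym (+-identityʳ _))
         (trans (cong (countᵇ _ X +_) (sym (∉⇒countᵇ≡0 _ v∉t))) (once 1≤v v≤N))))))
  where
  ∈X⇒∉t : ∀ {v} → v ∈ X → v ∉ listOf t
  ∈X⇒∉t v∈X v∈t = let 1≤v , v≤N = range v∈X in
    <⇒≢ (∈⇒countᵇ-pos v∈t) (sym (m+n≡1⇒n≡0 (∈⇒countᵇ-pos v∈X) (once 1≤v v≤N)))

length-complement : ∀ N {a b c} → 1 ≤ a → a < b → b < c → c ≤ N → length (complement N (a , b , c)) + 3 ≡ N
length-complement N {a} {b} {c} 1≤a a<b b<c c≤N =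
  trans (cong (length (complement N t) +_) (cong length (sym chosen≡t)))
        (trans (length-filter-∁ (_∈? listOf t) (interval 1 N)) (length-interval 1 N))
  where
  t = (a , b , c)
  chosen≡t : filter (_∈? listOf t) (interval 1 N) ≡ listOf t
  chosen≡t = increasing-⊆-antisym
    (AllPairs.filter⁺ (_∈? listOf t) (interval-increasing 1 N)) (listOf-increasing a<b b<c)
    (proj₂ ∘ ∈-filter⁻ (_∈? listOf t) {xs = interval 1 N})
    (λ v∈t → let 1≤v , v≤N = listOf-range 1≤a a<b b<c c≤N v∈t in
      ∈-filter⁺ (_∈? listOf t) (∈-interval⁺ 1 N 1≤v (s≤s v≤N)) v∈t)

-- Once a, b, c are written as 2 + a′, 4 + b′, 6 + c′ and a′, b′ are split into their first
-- cases, evaluation computes the first three values of the complement.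
complement-prefix : ∀ m a′ b′ c′ → ∃ λ x₁ → ∃ λ x₂ → ∃ λ x₃ → ∃ λ xs →
  complement (6 + m) (2 + a′ , 4 + b′ , 6 + c′) ≡ x₁ ∷ x₂ ∷ x₃ ∷ xs × x₁ < 2 + a′ × x₂ < 4 + b′ × x₃ < 6 + c′
complement-prefix m zero zero c′ = _ , _ , _ , _ , refl , m≤m+n 2 0 , m≤m+n 4 0 , m≤m+n 6 c′
complement-prefix m zero (suc b′) c′ = _ , _ , _ , _ , refl , m≤m+n 2 0 , m≤m+n 4 (suc b′) , m≤m+n 5 (suc c′)
complement-prefix m 1 zero c′ = _ , _ , _ , _ , refl , m≤m+n 2 1 , m≤m+n 3 1 , m≤m+n 6 c′
complement-prefix m 1 (suc b′) c′ = _ , _ , _ , _ , refl , m≤m+n 2 1 , m≤m+n 3 (suc (suc b′)) , m≤m+n 5 (suc c′)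
complement-prefix m (suc (suc a′)) b′ c′ =
  _ , _ , _ , _ , refl , m≤m+n 2 (suc (suc a′)) , m≤m+n 3 (suc b′) , m≤m+n 4 (suc (suc c′))

record SecondColumn (k a b c : ℕ) : Set where
  field
    2≤a   : 2 ≤ a
    a<b   : a < b
    b<c   : b < c
    c≤4+k : c ≤ 4 + k
    4≤b   : 4 ≤ b
    6≤c   : 6 ≤ c

SecondColumnOf : ℕ → Triple → Set
SecondColumnOf k (a , b , c) = SecondColumn k a b c

-- b exceeds the three distinct positive values x₁, x₂, a.
4≤b-of-distinct : ∀ {x₁ x₂ a b} → 1 ≤ x₁ → x₁ < x₂ → x₁ < a → a < b → x₂ < b → a ≢ x₂ → 4 ≤ b
4≤b-of-distinct {x₁} {x₂} {a} 1≤x₁ x₁<x₂ x₁<a a<b x₂<b a≢x₂ with <-cmp a x₂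
... | tri< a<x₂ _ _ = ≤-trans (s≤s (≤-trans (s≤s (≤-trans (s≤s 1≤x₁) x₁<a)) a<x₂)) x₂<b
... | tri≈ _ a≡x₂ _ = ⊥-elim (a≢x₂ a≡x₂)
... | tri> _ _ x₂<a = ≤-trans (s≤s (≤-trans (s≤s (≤-trans (s≤s 1≤x₁) x₁<x₂)) x₂<a)) a<b

<-chain-6 : ∀ {y₁ y₂ y₃ y₄ y₅ y₆} → 1 ≤ y₁ → y₁ < y₂ → y₂ < y₃ → y₃ < y₄ → y₄ < y₅ → y₅ < y₆ → 6 ≤ y₆
<-chain-6 p₁ p₂ p₃ p₄ p₅ p₆ =
  ≤-trans (s≤s (≤-trans (s≤s (≤-trans (s≤s (≤-trans (s≤s (≤-trans (s≤s p₁) p₂)) p₃)) p₄)) p₅)) p₆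

-- c exceeds the five distinct positive values x₁, x₂, x₃, a, b.
6≤c-of-distinct : ∀ {x₁ x₂ x₃ a b c} → 1 ≤ x₁ → x₁ < x₂ → x₂ < x₃ → x₃ < c → x₁ < a → a < b → b < c → x₂ < b →
                  a ≢ x₂ → a ≢ x₃ → b ≢ x₃ → 6 ≤ c
6≤c-of-distinct {x₁} {x₂} {x₃} {a} {b} 1≤x₁ x₁<x₂ x₂<x₃ x₃<c x₁<a a<b b<c x₂<b a≢x₂ a≢x₃ b≢x₃
  with <-cmp b x₃ | <-cmp a x₂ | <-cmp a x₃
... | tri≈ _ b≡x₃ _ | _ | _ = ⊥-elim (b≢x₃ b≡x₃)
... | _ | tri≈ _ a≡x₂ _ | _ = ⊥-elim (a≢x₂ a≡x₂)
... | _ | _ | tri≈ _ a≡x₃ _ = ⊥-elim (a≢x₃ a≡x₃)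
... | tri< b<x₃ _ _ | tri< a<x₂ _ _ | _ = <-chain-6 1≤x₁ x₁<a a<x₂ x₂<b b<x₃ x₃<c
... | tri< b<x₃ _ _ | tri> _ _ x₂<a | _ = <-chain-6 1≤x₁ x₁<x₂ x₂<a a<b b<x₃ x₃<c
... | tri> _ _ x₃<b | tri< a<x₂ _ _ | _ = <-chain-6 1≤x₁ x₁<a a<x₂ x₂<x₃ x₃<b b<c
... | tri> _ _ x₃<b | tri> _ _ x₂<a | tri< a<x₃ _ _ = <-chain-6 1≤x₁ x₁<x₂ x₂<a a<x₃ x₃<b b<c
... | tri> _ _ x₃<b | tri> _ _ x₂<a | tri> _ _ x₃<a = <-chain-6 1≤x₁ x₁<x₂ x₂<x₃ x₃<a a<b b<c

syt⇒sytTableau : ∀ k′ F → T (isSYTᵇ (hook2³1 (2 + k′)) F) →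
                 SecondColumnOf (2 + k′) (secondColumn F) × F ≡ sytTableau (2 + k′) (secondColumn F)
syt⇒sytTableau k′ F@((x₁ ∷ a ∷ []) ∷ (x₂ ∷ b ∷ []) ∷ (x₃ ∷ c ∷ []) ∷ R) h
  with parts ← sytᵇ⇒parts {hook2³1 (2 + k′)} F (sum-hook2³1 k′) h
  with _ , shape₂ ← ∷-injective (SYTParts.shape≡ parts)
  with _ , shape₃ ← ∷-injective shape₂
  with _ , shape₄ ← ∷-injective shape₃
  with xs , refl , _ ← singletons R k′ shape₄
  with r₁ ∷ r₂ ∷ r₃ ∷ _ ← SYTParts.rows parts
  with c₁₂ , c₂₋ ← T-∧⁻ (colIncᵇ (x₁ ∷ a ∷ []) (x₂ ∷ b ∷ [])) (SYTParts.columns parts)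
  with c₂₃ , c₃₋ ← T-∧⁻ (colIncᵇ (x₂ ∷ b ∷ []) (x₃ ∷ c ∷ [])) c₂₋
  with x₁<x₂ ∷ a<b ∷ [] ← colIncᵇ⇒Pointwise (x₁ ∷ a ∷ []) (x₂ ∷ b ∷ []) refl c₁₂
  with x₂<x₃ ∷ b<c ∷ [] ← colIncᵇ⇒Pointwise (x₂ ∷ b ∷ []) (x₃ ∷ c ∷ []) refl c₂₃ =
  second , cong (λ Y → twoColumnTableau Y t) X≡complement
  where
  open SYTParts parts
  t = (a , b , c)
  N = 4 + (2 + k′)
  X = x₁ ∷ x₂ ∷ x₃ ∷ xs
  X-increasing : Increasing X
  X-increasing = Linked⇒AllPairs <-trans (x₁<x₂ ∷ x₂<x₃ ∷ colsIncᵇ-singletons⁻ x₃ (c ∷ []) xs c₃₋)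
  X-range : ∀ {v} → v ∈ X → 1 ≤ v × v ≤ N
  X-range = in-range ∘ ∈-twoColumnTableau⁺ x₁ x₂ x₃ xs t ∘ inj₁
  X≡complement : X ≡ complement N t
  X≡complement = complement-unique N t X-increasing X-range
    (λ {v} 1≤v v≤N → trans (sym (countᵇ-twoColumnTableau v x₁ x₂ x₃ xs t)) (once 1≤v v≤N))
  ∉t : ∀ {v} → v ∈ X → v ∉ listOf t
  ∉t {v} v∈X = proj₂ (∈-complement⁻ N t (subst (v ∈_) X≡complement v∈X))
  x₁<a = <ᵇ⇒< x₁ a (proj₁ (T-∧⁻ (x₁ <ᵇ a) r₁))
  x₂<b = <ᵇ⇒< x₂ b (proj₁ (T-∧⁻ (x₂ <ᵇ b) r₂))
  x₃<c = <ᵇ⇒< x₃ c (proj₁ (T-∧⁻ (x₃ <ᵇ c) r₃))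
  1≤x₁ = proj₁ (X-range (here refl))
  second : SecondColumn (2 + k′) a b c
  second = record
    { 2≤a = ≤-trans (s≤s 1≤x₁) x₁<a
    ; a<b = a<b
    ; b<c = b<c
    ; c≤4+k = proj₂ (in-range (∈-twoColumnTableau⁺ x₁ x₂ x₃ xs t (inj₂ (there (there (here refl))))))
    ; 4≤b = 4≤b-of-distinct 1≤x₁ x₁<x₂ x₁<a a<b x₂<b (λ a≡x₂ → ∉t (there (here refl)) (here (sym a≡x₂)))
    ; 6≤c = 6≤c-of-distinct 1≤x₁ x₁<x₂ x₂<x₃ x₃<c x₁<a a<b b<c x₂<b
              (λ a≡x₂ → ∉t (there (here refl)) (here (sym a≡x₂)))
              (λ a≡x₃ → ∉t (there (there (here refl))) (here (sym a≡x₃)))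
              (λ b≡x₃ → ∉t (there (there (here refl))) (there (here (sym b≡x₃)))) }

complement-syt : ∀ k′ {x₁ x₂ x₃ xs a b c} → SecondColumn (2 + k′) a b c →
                 x₁ ∷ x₂ ∷ x₃ ∷ xs ≡ complement (4 + (2 + k′)) (a , b , c) → x₁ < a → x₂ < b → x₃ < c →
                 T (isSYTᵇ (hook2³1 (2 + k′)) (twoColumnTableau (x₁ ∷ x₂ ∷ x₃ ∷ xs) (a , b , c)))
complement-syt k′ {x₁} {x₂} {x₃} {xs} {a} {b} {c} sc X≡ x₁<a x₂<b x₃<c
  with x₁<x₂ ∷ x₂<x₃ ∷ x₃-linked
         ← AllPairs⇒Linked (subst Increasing (sym X≡) (complement-increasing (4 + (2 + k′)) (a , b , c))) =
  parts⇒sytᵇ (twoColumnTableau X t) (sum-hook2³1 k′) record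
    { shape≡ = cong (λ ys → 2 ∷ 2 ∷ 2 ∷ ys) (trans (length-singletons xs) (cong (λ n → replicate n 1) length-xs))
    ; rows = T-∧⁺ (<⇒<ᵇ x₁<a) _ ∷ T-∧⁺ (<⇒<ᵇ x₂<b) _ ∷ T-∧⁺ (<⇒<ᵇ x₃<c) _ ∷ singleton-rows xs
    ; columns = T-∧⁺ (Pointwise⇒colIncᵇ (x₁<x₂ ∷ a<b ∷ []))
                     (T-∧⁺ (Pointwise⇒colIncᵇ (x₂<x₃ ∷ b<c ∷ [])) (colsIncᵇ-singletons⁺ x₃ (c ∷ []) x₃-linked))
    ; in-range = in-range ∘ ∈-twoColumnTableau⁻ x₁ x₂ x₃ xs t
    ; once = λ {v} 1≤v v≤N → trans (countᵇ-twoColumnTableau v x₁ x₂ x₃ xs t)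
               (subst (λ Y → countᵇ v Y + countᵇ v (listOf t) ≡ 1) (sym X≡)
                      (countᵇ-complement N t (listOf-increasing a<b b<c) 1≤v v≤N)) }
  where
  open SecondColumn sc
  N = 4 + (2 + k′)
  t = (a , b , c)
  X = x₁ ∷ x₂ ∷ x₃ ∷ xs
  1≤a = ≤-trans (s≤s z≤n) 2≤a
  length-xs : length xs ≡ k′
  length-xs = +-cancelˡ-≡ 3 _ _ (trans (+-comm 3 (length xs)) (+-cancelˡ-≡ 3 _ _
    (trans (cong (λ Y → length Y + 3) X≡) (length-complement N 1≤a a<b b<c c≤4+k))))
  in-range : ∀ {v} → v ∈ X ⊎ v ∈ listOf t → 1 ≤ v × v ≤ N
  in-range (inj₁ v∈X) = proj₁ (∈-complement⁻ N t (subst (_ ∈_) X≡ v∈X))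
  in-range (inj₂ v∈t) = listOf-range 1≤a a<b b<c c≤4+k v∈t

sytTableau-valid : ∀ k′ {a b c} → SecondColumn (2 + k′) a b c →
                   T (isSYTᵇ (hook2³1 (2 + k′)) (sytTableau (2 + k′) (a , b , c))) ×
                   secondColumn (sytTableau (2 + k′) (a , b , c)) ≡ (a , b , c)
sytTableau-valid k′ sc
  with a′ , refl ← m≤n⇒∃[o]m+o≡n (SecondColumn.2≤a sc)
  with b′ , refl ← m≤n⇒∃[o]m+o≡n (SecondColumn.4≤b sc)
  with c′ , refl ← m≤n⇒∃[o]m+o≡n (SecondColumn.6≤c sc)
  with x₁ , x₂ , x₃ , xs , X≡ , x₁<a , x₂<b , x₃<c ← complement-prefix k′ a′ b′ c′ =
  subst (λ Y → T (isSYTᵇ (hook2³1 (2 + k′)) (twoColumnTableau Y t))) (sym X≡)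
        (complement-syt k′ sc (sym X≡) x₁<a x₂<b x₃<c) ,
  cong (λ Y → secondColumn (twoColumnTableau Y t)) X≡
  where t = (2 + a′ , 4 + b′ , 6 + c′)

syt⇄columns : ∀ k′ → Correspondence (T ∘ isSYTᵇ (hook2³1 (2 + k′))) (SecondColumnOf (2 + k′))
syt⇄columns k′ = record
  { to = secondColumn
  ; from = sytTableau (2 + k′)
  ; to-valid = λ F → proj₁ ∘ syt⇒sytTableau k′ F
  ; from-valid = λ (a , b , c) → proj₁ ∘ sytTableau-valid k′
  ; from∘to = λ F → sym ∘ proj₂ ∘ syt⇒sytTableau k′ F
  ; to∘from = λ (a , b , c) → proj₂ ∘ sytTableau-valid k′ }

-- From gap triples to second columns

gapsToColumn : ℕ → Triple → Triple
gapsToColumn k (t₁ , zero , t₃) = t₁ , 2 + t₁ , 4 + t₁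
gapsToColumn k (1 , 1 , 0) = 1 + k , 3 + k , 4 + k
gapsToColumn k (1 , 1 , 1) = 2 + k , 3 + k , 4 + k
gapsToColumn k (t₁ , t₂ , t₃) = 2 + t₃ , 3 + t₂ , 4 + t₁

-- The images under gapsToColumn of the triples with t₂ = 0, of (1, 1, 0) and of (1, 1, 1).
FlatImage : ℕ → ℕ → ℕ → Set
FlatImage a b c = b ≡ 2 + a × c ≡ 4 + a

CornerImage : ℕ → ℕ → ℕ → ℕ → ℕ → Set
CornerImage k i a b c = a ≡ i + k × b ≡ 3 + k × c ≡ 4 + k

columnToGaps : ℕ → Triple → Triple
columnToGaps k (a , b , c) with (b ≟ 2 + a) ×-dec (c ≟ 4 + a)
... | yes _ = a , 0 , 0
... | no _ with (a ≟ 1 + k) ×-dec (b ≟ 3 + k) ×-dec (c ≟ 4 + k)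
...   | yes _ = 1 , 1 , 0
...   | no _ with (a ≟ 2 + k) ×-dec (b ≟ 3 + k) ×-dec (c ≟ 4 + k)
...     | yes _ = 1 , 1 , 1
...     | no _ = c ∸ 4 , b ∸ 3 , a ∸ 2

columnToGaps-flat : ∀ k {a b c} → FlatImage a b c → columnToGaps k (a , b , c) ≡ (a , 0 , 0)
columnToGaps-flat k {a} {b} {c} flat with (b ≟ 2 + a) ×-dec (c ≟ 4 + a)
... | yes _ = refl
... | no ¬flat = ⊥-elim (¬flat flat)

columnToGaps-corner₁ : ∀ k {a b c} → ¬ FlatImage a b c → CornerImage k 1 a b c →
                       columnToGaps k (a , b , c) ≡ (1 , 1 , 0)
columnToGaps-corner₁ k {a} {b} {c} ¬flat corner with (b ≟ 2 + a) ×-dec (c ≟ 4 + a)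
... | yes flat = ⊥-elim (¬flat flat)
... | no _ with (a ≟ 1 + k) ×-dec (b ≟ 3 + k) ×-dec (c ≟ 4 + k)
...   | yes _ = refl
...   | no ¬corner = ⊥-elim (¬corner corner)

columnToGaps-corner₂ : ∀ k {a b c} → ¬ FlatImage a b c → ¬ CornerImage k 1 a b c → CornerImage k 2 a b c →
                       columnToGaps k (a , b , c) ≡ (1 , 1 , 1)
columnToGaps-corner₂ k {a} {b} {c} ¬flat ¬corner₁ corner with (b ≟ 2 + a) ×-dec (c ≟ 4 + a)
... | yes flat = ⊥-elim (¬flat flat)
... | no _ with (a ≟ 1 + k) ×-dec (b ≟ 3 + k) ×-dec (c ≟ 4 + k)
...   | yes corner₁ = ⊥-elim (¬corner₁ corner₁)
...   | no _ with (a ≟ 2 + k) ×-dec (b ≟ 3 + k) ×-dec (c ≟ 4 + k)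
...     | yes _ = refl
...     | no ¬corner = ⊥-elim (¬corner corner)

columnToGaps-generic : ∀ k {a b c} → ¬ FlatImage a b c → ¬ CornerImage k 1 a b c → ¬ CornerImage k 2 a b c →
                       columnToGaps k (a , b , c) ≡ (c ∸ 4 , b ∸ 3 , a ∸ 2)
columnToGaps-generic k {a} {b} {c} ¬flat ¬corner₁ ¬corner₂ with (b ≟ 2 + a) ×-dec (c ≟ 4 + a)
... | yes flat = ⊥-elim (¬flat flat)
... | no _ with (a ≟ 1 + k) ×-dec (b ≟ 3 + k) ×-dec (c ≟ 4 + k)
...   | yes corner₁ = ⊥-elim (¬corner₁ corner₁)
...   | no _ with (a ≟ 2 + k) ×-dec (b ≟ 3 + k) ×-dec (c ≟ 4 + k)
...     | yes corner₂ = ⊥-elim (¬corner₂ corner₂)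
...     | no _ = refl

gapsToColumn-second : ∀ {k} t → 2 ≤ k → AdmissibleGaps k t → SecondColumnOf k (gapsToColumn k t)
gapsToColumn-second (zero , _ , _) _ adm = ⊥-elim (Admissible.has-1 adm refl)
gapsToColumn-second (1 , zero , _) _ adm = ⊥-elim (Admissible.has-2 adm (refl , refl))
gapsToColumn-second (suc (suc t₁) , zero , _) _ adm = record
  { 2≤a = s≤s (s≤s z≤n) ; a<b = n≤1+n _ ; b<c = n≤1+n _
  ; c≤4+k = +-monoʳ-≤ 4 (Admissible.t₁≤k adm) ; 4≤b = m≤m+n 4 t₁ ; 6≤c = m≤m+n 6 t₁ }
gapsToColumn-second (1 , 1 , 0) 2≤k _ = record
  { 2≤a = s≤s (≤-trans (s≤s z≤n) 2≤k) ; a<b = n≤1+n _ ; b<c = ≤-refl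
  ; c≤4+k = ≤-refl ; 4≤b = s≤s (s≤s (s≤s (≤-trans (s≤s z≤n) 2≤k))) ; 6≤c = +-monoʳ-≤ 4 2≤k }
gapsToColumn-second (1 , 1 , 1) 2≤k _ = record
  { 2≤a = s≤s (s≤s z≤n) ; a<b = ≤-refl ; b<c = ≤-refl
  ; c≤4+k = ≤-refl ; 4≤b = s≤s (s≤s (s≤s (≤-trans (s≤s z≤n) 2≤k))) ; 6≤c = +-monoʳ-≤ 4 2≤k }
gapsToColumn-second (1 , 1 , suc (suc _)) _ adm with s≤s () ← Admissible.t₃≤t₂ adm
gapsToColumn-second (1 , suc (suc _) , _) _ adm with s≤s () ← Admissible.t₂≤t₁ adm
gapsToColumn-second (suc (suc t₁) , suc t₂ , t₃) _ adm = record
  { 2≤a = s≤s (s≤s z≤n) ; a<b = +-monoʳ-≤ 3 t₃≤t₂ ; b<c = +-monoʳ-≤ 4 t₂≤t₁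
  ; c≤4+k = +-monoʳ-≤ 4 t₁≤k ; 4≤b = m≤m+n 4 t₂ ; 6≤c = m≤m+n 6 t₁ }
  where open Admissible adm

generic-admissible : ∀ {k a b c} → SecondColumn k a b c →
                     ¬ FlatImage a b c → ¬ CornerImage k 1 a b c → ¬ CornerImage k 2 a b c →
                     Admissible k (c ∸ 4) (b ∸ 3) (a ∸ 2)
generic-admissible {k} sc ¬flat ¬corner₁ ¬corner₂
  with a′ , refl ← m≤n⇒∃[o]m+o≡n (SecondColumn.2≤a sc)
  with b′ , refl ← m≤n⇒∃[o]m+o≡n (SecondColumn.4≤b sc)
  with c′ , refl ← m≤n⇒∃[o]m+o≡n (SecondColumn.6≤c sc) = record
  { t₁≤k = +-cancelˡ-≤ 4 _ _ c≤4+k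
  ; t₂≤t₁ = +-cancelˡ-≤ 4 _ _ b<c
  ; t₃≤t₂ = +-cancelˡ-≤ 3 _ _ a<b
  ; t₃<k = ≤∧≢⇒< a′≤k a′≢k
  ; has-1 = λ ()
  ; has-2 = λ ()
  ; has-3+t₃ = λ { (refl , refl , _) → ¬flat (refl , refl) }
  ; has-2+k = λ { (refl , refl) → ¬corner₁ (refl , refl , ≤-antisym c≤4+k b<c) } }
  where
  open SecondColumn sc
  a′≤k : a′ ≤ k
  a′≤k = +-cancelˡ-≤ 4 _ _ (≤-trans (s≤s a<b) (≤-trans b<c c≤4+k))
  a′≢k : a′ ≢ k
  a′≢k refl = ¬corner₂ (refl , sym 3+k≡b , ≤-antisym c≤4+k (subst (λ b → suc b ≤ 6 + c′) (sym 3+k≡b) b<c))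
    where
    3+k≡b : 3 + a′ ≡ 4 + b′
    3+k≡b = ≤-antisym a<b (≤-pred (≤-trans b<c c≤4+k))

columnToGaps-admissible : ∀ {k} x → 2 ≤ k → SecondColumnOf k x → AdmissibleGaps k (columnToGaps k x)
columnToGaps-admissible {k} (a , b , c) 2≤k sc with (b ≟ 2 + a) ×-dec (c ≟ 4 + a)
... | yes (_ , c≡4+a) = record
  { t₁≤k = +-cancelˡ-≤ 4 a k (subst (_≤ 4 + k) c≡4+a c≤4+k) ; t₂≤t₁ = z≤n ; t₃≤t₂ = z≤n ; t₃<k = 0<k
  ; has-1 = λ a≡0 → <⇒≢ (≤-trans (s≤s z≤n) 2≤a) (sym a≡0)
  ; has-2 = λ (a≡1 , _) → <⇒≢ 2≤a (sym a≡1)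
  ; has-3+t₃ = λ (a≡1 , _) → <⇒≢ 2≤a (sym a≡1)
  ; has-2+k = λ (0≡k , _) → <⇒≢ 0<k 0≡k }
  where
  open SecondColumn sc
  0<k = ≤-trans (s≤s z≤n) 2≤k
... | no ¬flat with (a ≟ 1 + k) ×-dec (b ≟ 3 + k) ×-dec (c ≟ 4 + k)
...   | yes _ = record
  { t₁≤k = ≤-trans (s≤s z≤n) 2≤k ; t₂≤t₁ = ≤-refl ; t₃≤t₂ = z≤n ; t₃<k = ≤-trans (s≤s z≤n) 2≤k
  ; has-1 = λ () ; has-2 = λ () ; has-3+t₃ = λ () ; has-2+k = λ (1≡k , _) → <⇒≢ 2≤k 1≡k }
...   | no ¬corner₁ with (a ≟ 2 + k) ×-dec (b ≟ 3 + k) ×-dec (c ≟ 4 + k)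
...     | yes _ = record
  { t₁≤k = ≤-trans (s≤s z≤n) 2≤k ; t₂≤t₁ = ≤-refl ; t₃≤t₂ = ≤-refl ; t₃<k = 2≤k
  ; has-1 = λ () ; has-2 = λ () ; has-3+t₃ = λ () ; has-2+k = λ (1≡k , _) → <⇒≢ 2≤k 1≡k }
...     | no ¬corner₂ = generic-admissible sc ¬flat ¬corner₁ ¬corner₂

columnToGaps∘gapsToColumn : ∀ {k} t → AdmissibleGaps k t → columnToGaps k (gapsToColumn k t) ≡ t
columnToGaps∘gapsToColumn (zero , _ , _) adm = ⊥-elim (Admissible.has-1 adm refl)
columnToGaps∘gapsToColumn {k} (suc t₁ , zero , zero) _ = columnToGaps-flat k (refl , refl)
columnToGaps∘gapsToColumn (suc t₁ , zero , suc t₃) adm with () ← Admissible.t₃≤t₂ adm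
columnToGaps∘gapsToColumn {k} (1 , 1 , 0) _ =
  columnToGaps-corner₁ k (λ (_ , 4+k≡5+k) → 1+n≢n (sym (+-cancelˡ-≡ 4 _ _ 4+k≡5+k))) (refl , refl , refl)
columnToGaps∘gapsToColumn {k} (1 , 1 , 1) _ =
  columnToGaps-corner₂ k (λ (3+k≡4+k , _) → 1+n≢n (sym (+-cancelˡ-≡ 3 _ _ 3+k≡4+k)))
                         (λ (2+k≡1+k , _) → 1+n≢n 2+k≡1+k) (refl , refl , refl)
columnToGaps∘gapsToColumn (1 , 1 , suc (suc _)) adm with s≤s () ← Admissible.t₃≤t₂ adm
columnToGaps∘gapsToColumn (1 , suc (suc _) , _) adm with s≤s () ← Admissible.t₂≤t₁ adm
columnToGaps∘gapsToColumn {k} (suc (suc t₁) , suc t₂ , t₃) adm =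
  columnToGaps-generic k {2 + t₃} {3 + suc t₂} {4 + suc (suc t₁)}
    (λ { (refl , refl) → has-3+t₃ (refl , refl , t₁≤k) })
    (λ { (2+t₃≡1+k , refl , _) → has-2+k (refl , suc-injective 2+t₃≡1+k) })
    (λ (2+t₃≡2+k , _) → <⇒≢ t₃<k (+-cancelˡ-≡ 2 _ _ 2+t₃≡2+k))
  where open Admissible adm

gapsToColumn∘columnToGaps : ∀ {k} x → SecondColumnOf k x → gapsToColumn k (columnToGaps k x) ≡ x
gapsToColumn∘columnToGaps {k} (a , b , c) sc with (b ≟ 2 + a) ×-dec (c ≟ 4 + a)
... | yes (refl , refl) = refl
... | no _ with (a ≟ 1 + k) ×-dec (b ≟ 3 + k) ×-dec (c ≟ 4 + k)
...   | yes (refl , refl , refl) = refl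
...   | no _ with (a ≟ 2 + k) ×-dec (b ≟ 3 + k) ×-dec (c ≟ 4 + k)
...     | yes (refl , refl , refl) = refl
...     | no _
  with a′ , refl ← m≤n⇒∃[o]m+o≡n (SecondColumn.2≤a sc)
  with b′ , refl ← m≤n⇒∃[o]m+o≡n (SecondColumn.4≤b sc)
  with c′ , refl ← m≤n⇒∃[o]m+o≡n (SecondColumn.6≤c sc) = refl

gaps⇄columns : ∀ k → 2 ≤ k → Correspondence (AdmissibleGaps k) (SecondColumnOf k)
gaps⇄columns k 2≤k = record
  { to = gapsToColumn k
  ; from = columnToGaps k
  ; to-valid = λ t → gapsToColumn-second t 2≤k
  ; from-valid = λ x → columnToGaps-admissible x 2≤k
  ; from∘to = columnToGaps∘gapsToColumn
  ; to∘from = gapsToColumn∘columnToGaps }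

proposition1p1 : (k : ℕ) → 1 < k → IncPacked (3 + k) (rect3 k) ↔ SYT (hook2³1 k)
proposition1p1 1 (s≤s ())
proposition1p1 (suc (suc k′)) 2≤k = Correspondence⇒↔ T-irrelevant T-irrelevant
  (packed⇄gaps k 2≤k ⨾ gaps⇄columns k 2≤k ⨾ Correspondence-sym (syt⇄columns k′))
  where k = 2 + k′
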